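{- Let $\beta:\mathbb{N}\setminus\{0\}\to\mathbb{N}$ be any computable function. Then the following two statements cannot both be true: (A) (Matiyasevich's conjecture) for every positive integer $n$, every recursively enumerable set $\mathcal{M}\subseteq\mathbb{N}^n$ has a finite-fold Diophantine representation; (B) for every positive integer $n$ and every system $S\subseteq E_n$ which has only finitely many solutions in integers $x_1,\ldots,x_n$, each such solution satisfies $|x_1|,\ldots,|x_n|\le \beta(n)$.
   Context: $\mathbb{N}=\{0,1,2,\ldots\}$. For a positive integer $n$, $E_n=\{x_i=1,\ x_i+x_j=x_k,\ x_i\cdot x_j=x_k:\ i,j,k\in\{1,\ldots,n\}\}$; a system $S\subseteq E_n$ is a set of such equations in the variables $x_1,\ldots,x_n$. A Diophantine representation of $\mathcal{M}\subseteq\mathbb{N}^n$ is a polynomial $W$ with integer coefficients such that for all $(a_1,\ldots,a_n)\in\mathbb{N}^n$: $(a_1,\ldots,a_n)\in\mathcal{M}\iff \exists x_1,\ldots,x_m\in\mathbb{N}\ W(a_1,\ldots,a_n,x_1,\ldots,x_m)=0$. It is finite-fold if for all $a_1,\ldots,a_n\in\mathbb{N}$ the equation $W(a_1,\ldots,a_n,x_1,\ldots,x_m)=0$ has at most finitely many solutions $(x_1,\ldots,x_m)\in\mathbb{N}^m$. -}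

module Defs where

open import Data.Nat using (ℕ; zero; suc; _<_; _≤_)
open import Data.Integer using (ℤ; +_; _+_; _*_; ∣_∣)
open import Data.Fin using (Fin)
open import Data.Vec using (Vec; []; _∷_; lookup; _++_; map)
open import Data.List using (List)
open import Data.List.Membership.Propositional using (_∈_)
open import Data.List.Relation.Unary.All using (All)
open import Data.Product using (Σ; ∃; _×_)
open import Function.Bundles using (_⇔_)
open import Relation.Binary.PropositionalEquality using (_≡_)

data PR : ℕ → Set where
  zer  : ∀ {n} → PR n
  succ : PR 1
  proj : ∀ {n} → Fin n → PR n
  comp : ∀ {m n} → PR m → Vec (PR n) m → PR n
  prec : ∀ {n} → PR n → PR (suc (suc n)) → PR (suc n)
  mu   : ∀ {n} → PR (suc n) → PR n

mutual
  data _⊢_⇓_ : ∀ {n} → PR n → Vec ℕ n → ℕ → Set where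
    ev-zer  : ∀ {n} {xs : Vec ℕ n} → zer ⊢ xs ⇓ 0
    ev-succ : ∀ {x} → succ ⊢ (x ∷ []) ⇓ suc x
    ev-proj : ∀ {n} {i : Fin n} {xs} → proj i ⊢ xs ⇓ lookup xs i
    ev-comp : ∀ {m n} {f : PR m} {gs : Vec (PR n) m} {xs ys y} →
              gs ⊢* xs ⇓ ys → f ⊢ ys ⇓ y → comp f gs ⊢ xs ⇓ y
    ev-prec-z : ∀ {n} {g : PR n} {h : PR (suc (suc n))} {xs y} →
              g ⊢ xs ⇓ y → prec g h ⊢ (0 ∷ xs) ⇓ y
    ev-prec-s : ∀ {n} {g : PR n} {h : PR (suc (suc n))} {k xs r y} →
              prec g h ⊢ (k ∷ xs) ⇓ r → h ⊢ (k ∷ r ∷ xs) ⇓ y →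
              prec g h ⊢ (suc k ∷ xs) ⇓ y
    ev-mu   : ∀ {n} {f : PR (suc n)} {xs y} →
              f ⊢ (y ∷ xs) ⇓ 0 →
              (∀ z → z < y → Σ ℕ (λ w → f ⊢ (z ∷ xs) ⇓ suc w)) →
              mu f ⊢ xs ⇓ y

  data _⊢*_⇓_ : ∀ {m n} → Vec (PR n) m → Vec ℕ n → Vec ℕ m → Set where
    ev-[] : ∀ {n} {xs : Vec ℕ n} → [] ⊢* xs ⇓ []
    ev-∷  : ∀ {m n} {g : PR n} {gs : Vec (PR n) m} {xs y ys} →
            g ⊢ xs ⇓ y → gs ⊢* xs ⇓ ys → (g ∷ gs) ⊢* xs ⇓ (y ∷ ys)

Computable : (ℕ → ℕ) → Set
Computable f = Σ (PR 1) λ c → ∀ x → c ⊢ (x ∷ []) ⇓ f x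

RecursivelyEnumerable : (n : ℕ) → (Vec ℕ n → Set) → Set
RecursivelyEnumerable n M =
  Σ (PR n) λ c → ∀ a → M a ⇔ ∃ λ y → c ⊢ a ⇓ y

data Poly (k : ℕ) : Set where
  var  : Fin k → Poly k
  con  : ℤ → Poly k
  _⊕_  : Poly k → Poly k → Poly k
  _⊗_  : Poly k → Poly k → Poly k

⟦_⟧ : ∀ {k} → Poly k → Vec ℤ k → ℤ
⟦ var i ⟧ v = lookup v i
⟦ con c ⟧ v = c
⟦ p ⊕ q ⟧ v = ⟦ p ⟧ v + ⟦ q ⟧ v
⟦ p ⊗ q ⟧ v = ⟦ p ⟧ v * ⟦ q ⟧ v

toℤs : ∀ {k} → Vec ℕ k → Vec ℤ k
toℤs = map (λ k → + k)

IsDiophantineRep : (n m : ℕ) → (Vec ℕ n → Set) → Poly (n Data.Nat.+ m) → Set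
IsDiophantineRep n m M W =
  ∀ (a : Vec ℕ n) → M a ⇔ ∃ λ (x : Vec ℕ m) → ⟦ W ⟧ (toℤs (a ++ x)) ≡ + 0

IsFiniteFold : (n m : ℕ) → Poly (n Data.Nat.+ m) → Set
IsFiniteFold n m W =
  ∀ (a : Vec ℕ n) → Σ (List (Vec ℕ m)) λ L →
    ∀ (x : Vec ℕ m) → ⟦ W ⟧ (toℤs (a ++ x)) ≡ + 0 → x ∈ L

HasFiniteFoldDiophantineRep : (n : ℕ) → (Vec ℕ n → Set) → Set
HasFiniteFoldDiophantineRep n M =
  Σ ℕ λ m → Σ (Poly (n Data.Nat.+ m)) λ W →
    IsDiophantineRep n m M W × IsFiniteFold n m W

data Equation (n : ℕ) : Set where
  one : Fin n → Equation n
  add : Fin n → Fin n → Fin n → Equation n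
  mul : Fin n → Fin n → Fin n → Equation n

SatisfiesEq : ∀ {n} → Vec ℤ n → Equation n → Set
SatisfiesEq x (one i)     = lookup x i ≡ + 1
SatisfiesEq x (add i j k) = lookup x i + lookup x j ≡ lookup x k
SatisfiesEq x (mul i j k) = lookup x i * lookup x j ≡ lookup x k

System : ℕ → Set
System n = List (Equation n)

Solves : ∀ {n} → Vec ℤ n → System n → Set
Solves x S = All (SatisfiesEq x) S

FinitelyManySolutions : ∀ {n} → System n → Set
FinitelyManySolutions {n} S =
  Σ (List (Vec ℤ n)) λ L → ∀ (x : Vec ℤ n) → Solves x S → x ∈ L

-- The set M = {(t, b) | b ≤ β t + 1} is recursively enumerable, so (A) gives a finite-fold
-- Diophantine representation W(t, b, x₁, …, xₘ) of it.  Writing every unknown as a sum of four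
-- integer squares (Lagrange), the equation W(2ᵏ, b, x) = 0 is compiled into a straight-line
-- program whose instructions are equations of E_n, n = 2ᵏ; for large k the program fits into
-- n registers.  Every solution of the resulting system is determined by its inputs, which
-- represent a natural solution of W(n, b, x) = 0; since b ≤ β n + 1 and W is finite-fold,
-- these are bounded, so the system has finitely many solutions.  But (n, β n + 1) ∈ M yields
-- a solution with an entry β n + 1 > β n, contradicting (B).
module Submission where
open import Defs
open import Data.Nat using (ℕ; _≤_)
open import Data.Integer using (∣_∣)
open import Data.Fin using (Fin)
open import Data.Vec using (Vec; lookup)
open import Data.Product using (_×_)
open import Relation.Nullary using (¬_)
open import Data.Integer using (ℤ)
open import Data.Nat using (s≤s; z≤n)
open import Data.Nat.Properties using (<-irrefl)
open import Data.Product using (_,_)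
open import Relation.Binary.PropositionalEquality using (refl; subst)

-- Lagrange's four-square theorem, via Euler's identity and descent.
module FourSquares where
  open import Data.Nat as ℕ using (ℕ; zero; suc; z≤n; s≤s)
  import Data.Nat.Properties as ℕP
  open import Data.Product using (Σ; _,_; _×_; proj₁; proj₂)
  open import Data.Sum using (_⊎_; inj₁; inj₂; [_,_]′)
  open import Data.Empty using (⊥-elim)
  open import Relation.Binary.PropositionalEquality
  open import Relation.Nullary using (yes; no; ¬_)

  module NaturalSquares where
    open import Data.Nat
    open import Data.Nat.Properties
    open import Data.Nat.Tactic.RingSolver using (solve-∀)

    sum4ℕ : ℕ → ℕ → ℕ → ℕ → ℕ
    sum4ℕ a b c d = a * a + b * b + c * c + d * d

    private
      four-halves : ∀ a b c d →
        (2 * a) * (2 * a) + (2 * b) * (2 * b) + (2 * c) * (2 * c) + (2 * d) * (2 * d)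
          ≡ 4 * (a * a + b * b + c * c + d * d)
      four-halves = solve-∀

      four-m² : ∀ m → m * m + m * m + m * m + m * m ≡ 4 * (m * m)
      four-m² = solve-∀

    sum4ℕ-halfBound : ∀ {a b c d m} → 2 * a ≤ m → 2 * b ≤ m → 2 * c ≤ m → 2 * d ≤ m →
      sum4ℕ a b c d ≤ m * m
    sum4ℕ-halfBound {a} {b} {c} {d} {m} ha hb hc hd = *-cancelˡ-≤ 4 (begin
      4 * sum4ℕ a b c d                                  ≡⟨ four-halves a b c d ⟨
      (2 * a) * (2 * a) + (2 * b) * (2 * b) + (2 * c) * (2 * c) + (2 * d) * (2 * d)
        ≤⟨ +-mono-≤ (+-mono-≤ (+-mono-≤ (*-mono-≤ ha ha) (*-mono-≤ hb hb)) (*-mono-≤ hc hc)) (*-mono-≤ hd hd) ⟩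
      m * m + m * m + m * m + m * m                      ≡⟨ four-m² m ⟩
      4 * (m * m)                                        ∎)
      where open ≤-Reasoning

    private
      sum4ℕ-halfBound-strict : ∀ {a b c d m} → 2 * a < m → 2 * b ≤ m → 2 * c ≤ m → 2 * d ≤ m →
        sum4ℕ a b c d < m * m
      sum4ℕ-halfBound-strict {a} {b} {c} {d} {m} ha hb hc hd = *-cancelˡ-< 4 _ _ (begin-strict
        4 * sum4ℕ a b c d                                ≡⟨ four-halves a b c d ⟨
        (2 * a) * (2 * a) + (2 * b) * (2 * b) + (2 * c) * (2 * c) + (2 * d) * (2 * d)
          <⟨ +-mono-<-≤ (+-mono-<-≤ (+-mono-<-≤ (*-mono-< ha ha) (*-mono-≤ hb hb)) (*-mono-≤ hc hc)) (*-mono-≤ hd hd) ⟩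
        m * m + m * m + m * m + m * m                    ≡⟨ four-m² m ⟩
        4 * (m * m)                                      ∎)
        where open ≤-Reasoning

      first-tight : ∀ {a b c d m} → 2 * a ≤ m → 2 * b ≤ m → 2 * c ≤ m → 2 * d ≤ m →
        sum4ℕ a b c d ≡ m * m → 2 * a ≡ m
      first-tight {a} {b} {c} {d} ha hb hc hd eq with m≤n⇒m<n∨m≡n ha
      ... | inj₂ tight = tight
      ... | inj₁ lt = ⊥-elim (<-irrefl eq (sum4ℕ-halfBound-strict {a} {b} {c} {d} lt hb hc hd))

      swap₂ : ∀ a b c d → a * a + b * b + c * c + d * d ≡ b * b + a * a + c * c + d * d
      swap₂ = solve-∀
      swap₃ : ∀ a b c d → a * a + b * b + c * c + d * d ≡ c * c + b * b + a * a + d * d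
      swap₃ = solve-∀
      swap₄ : ∀ a b c d → a * a + b * b + c * c + d * d ≡ d * d + b * b + c * c + a * a
      swap₄ = solve-∀

    sum4ℕ-halfBound-tight : ∀ {a b c d m} → 2 * a ≤ m → 2 * b ≤ m → 2 * c ≤ m → 2 * d ≤ m →
      sum4ℕ a b c d ≡ m * m → (2 * a ≡ m) × (2 * b ≡ m) × (2 * c ≡ m) × (2 * d ≡ m)
    sum4ℕ-halfBound-tight {a} {b} {c} {d} ha hb hc hd eq =
      first-tight {a} {b} {c} {d} ha hb hc hd eq ,
      first-tight {b} {a} {c} {d} hb ha hc hd (trans (sym (swap₂ a b c d)) eq) ,
      first-tight {c} {b} {a} {d} hc hb ha hd (trans (sym (swap₃ a b c d)) eq) ,
      first-tight {d} {b} {c} {a} hd hb hc ha (trans (sym (swap₄ a b c d)) eq)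

    ≤sum4ℕ : ∀ a b c d → (a ≤ sum4ℕ a b c d) × (b ≤ sum4ℕ a b c d) × (c ≤ sum4ℕ a b c d) × (d ≤ sum4ℕ a b c d)
    ≤sum4ℕ a b c d = first≤ a b c d , subst (b ≤_) (sym (swap₂ a b c d)) (first≤ b a c d) ,
      subst (c ≤_) (sym (swap₃ a b c d)) (first≤ c b a d) , subst (d ≤_) (sym (swap₄ a b c d)) (first≤ d b c a)
      where
      n≤n*n : ∀ n → n ≤ n * n
      n≤n*n zero    = z≤n
      n≤n*n (suc n) = m≤m*n (suc n) (suc n)
      first≤ : ∀ a b c d → a ≤ sum4ℕ a b c d
      first≤ a b c d = ≤-trans (n≤n*n a) (≤-trans (m≤m+n (a * a) (b * b)) (≤-trans (m≤m+n _ (c * c)) (m≤m+n _ (d * d))))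

    sum4ℕ≡0 : ∀ {a b c d} → sum4ℕ a b c d ≡ 0 → (a ≡ 0) × (b ≡ 0) × (c ≡ 0) × (d ≡ 0)
    sum4ℕ≡0 {zero} {zero} {zero} {zero} _ = refl , refl , refl , refl
    sum4ℕ≡0 {zero} {zero} {zero} {suc d} ()
    sum4ℕ≡0 {zero} {zero} {suc c} {d} ()
    sum4ℕ≡0 {zero} {suc b} {c} {d} ()
    sum4ℕ≡0 {suc a} {b} {c} {d} ()

  open NaturalSquares public using (sum4ℕ; ≤sum4ℕ)
  open NaturalSquares using (sum4ℕ-halfBound; sum4ℕ-halfBound-tight; sum4ℕ≡0)

  -- For an odd prime p = 2h + 1 there are a, b ≤ h with p ∣ a² + b² + 1.  The h + 1 residues
  -- a² mod p (a ≤ h) are pairwise distinct, and so are the h + 1 numbers 2h − (b² mod p); by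
  -- the pigeonhole principle two of these 2h + 2 numbers below p coincide, and the coincidence
  -- must be a² ≡ −1 − b² (mod p).
  module SquaresModOddPrime (h : ℕ) where
    open import Data.Nat
    open import Data.Nat.Properties
    open import Data.Nat.DivMod
    open import Data.Nat.Divisibility
    open import Data.Nat.Primality using (Prime; euclidsLemma)
    open import Data.Nat.Tactic.RingSolver using (solve-∀)
    open import Data.Fin using (Fin; toℕ; fromℕ<; splitAt; join)
    import Data.Fin.Properties as FinP
    open import Relation.Binary using (tri<; tri≈; tri>)
    open import Function using (_∘_)

    p : ℕ
    p = suc (h + h)

    sqMod : ℕ → ℕ
    sqMod a = (a * a) % p

    private
      ∣-if-%-equal : ∀ x y → x % p ≡ (x + y) % p → p ∣ y
      ∣-if-%-equal x y eq = ∣m+n∣m⇒∣n {p} {(x / p) * p} {y} (divides ((x + y) / p) quotients) (n∣m*n (x / p))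
        where
        open ≡-Reasoning
        quotients : (x / p) * p + y ≡ ((x + y) / p) * p
        quotients = +-cancelˡ-≡ (x % p) _ _ (begin
          x % p + ((x / p) * p + y)         ≡⟨ +-assoc (x % p) ((x / p) * p) y ⟨
          x % p + (x / p) * p + y           ≡⟨ cong (_+ y) (m≡m%n+[m/n]*n x p) ⟨
          x + y                             ≡⟨ m≡m%n+[m/n]*n (x + y) p ⟩
          (x + y) % p + ((x + y) / p) * p   ≡⟨ cong (_+ ((x + y) / p) * p) eq ⟨
          x % p + ((x + y) / p) * p         ∎)

      square-difference : ∀ d a → (d + a) * (d + a) ≡ a * a + d * ((d + a) + a)
      square-difference = solve-∀

    -- Distinct a < b ≤ h have distinct squares mod p: p ∣ (b − a)(b + a) is impossible.
    squares-distinct : Prime p → ∀ a b → a < b → b ≤ h → sqMod a ≢ sqMod b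
    squares-distinct pr a b a<b b≤h eq = [ p∤d , p∤b+a ]′ (euclidsLemma d (b + a) pr p∣product)
      where
      d = b ∸ a
      b≡d+a : b ≡ d + a
      b≡d+a = sym (m∸n+n≡m (<⇒≤ a<b))
      p∣product : p ∣ d * (b + a)
      p∣product = ∣-if-%-equal (a * a) (d * (b + a)) (trans eq (cong (_% p)
        (trans (cong (λ t → t * t) b≡d+a)
          (trans (square-difference d a) (cong (λ t → a * a + d * (t + a)) (sym b≡d+a))))))
      p∤d : ¬ (p ∣ d)
      p∤d p∣d = <⇒≱ (s≤s (≤-trans (m∸n≤m b a) (≤-trans b≤h (m≤m+n h h))))
                    (∣⇒≤ {{>-nonZero (m<n⇒0<n∸m a<b)}} p∣d)
      p∤b+a : ¬ (p ∣ b + a)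
      p∤b+a p∣b+a = <⇒≱ (s≤s (+-mono-≤ b≤h (≤-trans (<⇒≤ a<b) b≤h)))
                        (∣⇒≤ {{>-nonZero (≤-trans (≤-trans (m<n⇒0<n∸m a<b) (m∸n≤m b a)) (m≤m+n b a))}} p∣b+a)

    complementary-residues : ∀ a b → sqMod a ≡ h + h ∸ sqMod b → p ∣ a * a + b * b + 1
    complementary-residues a b eq = divides (suc (a * a / p + b * b / p)) (begin
      a * a + b * b + 1
        ≡⟨ cong₂ (λ u v → u + v + 1) (m≡m%n+[m/n]*n (a * a) p) (m≡m%n+[m/n]*n (b * b) p) ⟩
      (sqMod a + (a * a / p) * p) + (sqMod b + (b * b / p) * p) + 1
        ≡⟨ regroup (sqMod a) (sqMod b) ((a * a / p) * p) ((b * b / p) * p) ⟩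
      suc (sqMod a + sqMod b) + ((a * a / p) * p + (b * b / p) * p)
        ≡⟨ cong (λ t → suc t + ((a * a / p) * p + (b * b / p) * p)) residues-sum ⟩
      p + ((a * a / p) * p + (b * b / p) * p)
        ≡⟨ cong (p +_) (*-distribʳ-+ p (a * a / p) (b * b / p)) ⟨
      p + (a * a / p + b * b / p) * p     ∎)
      where
      open ≡-Reasoning
      regroup : ∀ x y z w → x + z + (y + w) + 1 ≡ suc (x + y) + (z + w)
      regroup = solve-∀
      residues-sum : sqMod a + sqMod b ≡ h + h
      residues-sum = trans (cong (_+ sqMod b) eq) (m∸n+n≡m (s≤s⁻¹ (m%n<n (b * b) p)))

    pigeon : Fin (suc h) ⊎ Fin (suc h) → Fin p
    pigeon (inj₁ a) = fromℕ< (m%n<n (toℕ a * toℕ a) p)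
    pigeon (inj₂ b) = fromℕ< (s≤s (m∸n≤m (h + h) (sqMod (toℕ b))))

    private
      pigeon-square : ∀ a → toℕ (pigeon (inj₁ a)) ≡ sqMod (toℕ a)
      pigeon-square a = FinP.toℕ-fromℕ< _

      pigeon-complement : ∀ b → toℕ (pigeon (inj₂ b)) ≡ h + h ∸ sqMod (toℕ b)
      pigeon-complement b = FinP.toℕ-fromℕ< _

      squares-injective : Prime p → ∀ (a a' : Fin (suc h)) → a ≢ a' → sqMod (toℕ a) ≢ sqMod (toℕ a')
      squares-injective pr a a' a≢a' eq with <-cmp (toℕ a) (toℕ a')
      ... | tri< lt _ _ = squares-distinct pr (toℕ a) (toℕ a') lt (s≤s⁻¹ (FinP.toℕ<n a')) eq
      ... | tri≈ _ e _  = a≢a' (FinP.toℕ-injective e)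
      ... | tri> _ _ gt = squares-distinct pr (toℕ a') (toℕ a) gt (s≤s⁻¹ (FinP.toℕ<n a)) (sym eq)

    SumOfSquaresPlusOneMultiple : Set
    SumOfSquaresPlusOneMultiple = Σ ℕ λ a → Σ ℕ λ b → a ≤ h × b ≤ h × p ∣ a * a + b * b + 1

    -- Any collision of two distinct pigeons is a mixed one, which yields a and b.
    collision : Prime p → ∀ s t → s ≢ t → pigeon s ≡ pigeon t → SumOfSquaresPlusOneMultiple
    collision pr (inj₁ a) (inj₁ a') s≢t eq = ⊥-elim (squares-injective pr a a' (s≢t ∘ cong inj₁)
      (trans (sym (pigeon-square a)) (trans (cong toℕ eq) (pigeon-square a'))))
    collision pr (inj₂ b) (inj₂ b') s≢t eq = ⊥-elim (squares-injective pr b b' (s≢t ∘ cong inj₂)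
      (∸-cancelˡ-≡ (s≤s⁻¹ (m%n<n (toℕ b * toℕ b) p)) (s≤s⁻¹ (m%n<n (toℕ b' * toℕ b') p))
        (trans (sym (pigeon-complement b)) (trans (cong toℕ eq) (pigeon-complement b')))))
    collision pr (inj₁ a) (inj₂ b) _ eq = toℕ a , toℕ b , s≤s⁻¹ (FinP.toℕ<n a) , s≤s⁻¹ (FinP.toℕ<n b) ,
      complementary-residues (toℕ a) (toℕ b) (trans (sym (pigeon-square a)) (trans (cong toℕ eq) (pigeon-complement b)))
    collision pr (inj₂ b) (inj₁ a) _ eq = toℕ a , toℕ b , s≤s⁻¹ (FinP.toℕ<n a) , s≤s⁻¹ (FinP.toℕ<n b) ,
      complementary-residues (toℕ a) (toℕ b) (trans (sym (pigeon-square a)) (trans (cong toℕ (sym eq)) (pigeon-complement b)))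

    sumOfSquaresPlusOneMultiple : Prime p → SumOfSquaresPlusOneMultiple
    sumOfSquaresPlusOneMultiple pr with FinP.pigeonhole p<2h+2 (pigeon ∘ splitAt (suc h))
      where
      p<2h+2 : p < suc h + suc h
      p<2h+2 = s≤s (≤-reflexive (sym (+-suc h h)))
    ... | i , j , i<j , eq = collision pr (splitAt (suc h) i) (splitAt (suc h) j) split-distinct eq
      where
      split-distinct : splitAt (suc h) i ≢ splitAt (suc h) j
      split-distinct e = FinP.<-irrefl (trans (sym (FinP.join-splitAt (suc h) (suc h) i))
        (trans (cong (join (suc h) (suc h)) e) (FinP.join-splitAt (suc h) (suc h) j))) i<j

  open import Data.Integer using (ℤ; +_; -[1+_]; ∣_∣; _⊖_; _+_; _*_; -_; _-_)
  import Data.Integer.Properties as ℤP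
  open import Data.Integer.DivMod using (_%ℕ_; _/ℕ_; a≡a%ℕn+[a/ℕn]*n; n%ℕd<d)
  open import Data.Integer.Tactic.RingSolver using (solve-∀)

  sum4 : ℤ → ℤ → ℤ → ℤ → ℤ
  sum4 a b c d = a * a + b * b + c * c + d * d

  SumOfFourSquares : ℕ → Set
  SumOfFourSquares n = Σ ℤ λ a → Σ ℤ λ b → Σ ℤ λ c → Σ ℤ λ d → + n ≡ sum4 a b c d

  square-∣∣ : ∀ a → a * a ≡ + (∣ a ∣ ℕ.* ∣ a ∣)
  square-∣∣ (+ zero)  = refl
  square-∣∣ (+ suc n) = refl
  square-∣∣ -[1+ n ]  = refl

  sum4-∣∣ : ∀ a b c d → sum4 a b c d ≡ + sum4ℕ (∣ a ∣) (∣ b ∣) (∣ c ∣) (∣ d ∣)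
  sum4-∣∣ a b c d rewrite square-∣∣ a | square-∣∣ b | square-∣∣ c | square-∣∣ d = refl

  module EulerIdentity where
    private
      -- The ring solver needs the squares spelled out; euler-identity restates it with sum4.
      euler-expanded : ∀ a b c d x y z w →
        (a * a + b * b + c * c + d * d) * (x * x + y * y + z * z + w * w) ≡
        (a * x + b * y + c * z + d * w) * (a * x + b * y + c * z + d * w)
          + (a * y - b * x + c * w - d * z) * (a * y - b * x + c * w - d * z)
          + (a * z - b * w - c * x + d * y) * (a * z - b * w - c * x + d * y)
          + (a * w + b * z - c * y - d * x) * (a * w + b * z - c * y - d * x)
      euler-expanded = solve-∀

      euler-identity : ∀ a b c d x y z w →
        sum4 a b c d * sum4 x y z w ≡
        sum4 (a * x + b * y + c * z + d * w) (a * y - b * x + c * w - d * z)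
             (a * z - b * w - c * x + d * y) (a * w + b * z - c * y - d * x)
      euler-identity = euler-expanded

    sumOfFourSquares-* : ∀ {a b} → SumOfFourSquares a → SumOfFourSquares b → SumOfFourSquares (a ℕ.* b)
    sumOfFourSquares-* {a} {b} (x1 , x2 , x3 , x4 , ha) (y1 , y2 , y3 , y4 , hb) =
      (x1 * y1 + x2 * y2 + x3 * y3 + x4 * y4) , (x1 * y2 - x2 * y1 + x3 * y4 - x4 * y3) ,
      (x1 * y3 - x2 * y4 - x3 * y1 + x4 * y2) , (x1 * y4 + x2 * y3 - x3 * y2 - x4 * y1) ,
      trans (ℤP.pos-* a b) (trans (cong₂ _*_ ha hb) (euler-identity x1 x2 x3 x4 y1 y2 y3 y4))

  open EulerIdentity using (sumOfFourSquares-*)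

  record SymmetricResidue (m : ℕ) (x : ℤ) : Set where
    constructor symRes
    field
      quot  : ℤ
      res   : ℤ
      split : x ≡ res + + m * quot
      small : 2 ℕ.* ∣ res ∣ ℕ.≤ m

  symmetricResidue : ∀ x m .{{_ : ℕ.NonZero m}} → SymmetricResidue m x
  symmetricResidue x m with 2 ℕ.* (x %ℕ m) ℕ.≤? m
  ... | yes small = symRes (x /ℕ m) (+ (x %ℕ m)) split small
    where
    split : x ≡ + (x %ℕ m) + + m * (x /ℕ m)
    split = trans (a≡a%ℕn+[a/ℕn]*n x m) (cong (λ t → + (x %ℕ m) + t) (ℤP.*-comm (x /ℕ m) (+ m)))
  ... | no large = symRes (q + + 1) (r ⊖ m) split small
    where
    r = x %ℕ m
    q = x /ℕ m
    shift : ∀ a b c → a + b * c ≡ (a + - c) + c * (b + + 1)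
    shift = solve-∀
    split : x ≡ (r ⊖ m) + + m * (q + + 1)
    split = begin
      x                                 ≡⟨ a≡a%ℕn+[a/ℕn]*n x m ⟩
      + r + q * + m                     ≡⟨ shift (+ r) q (+ m) ⟩
      (+ r + - + m) + + m * (q + + 1)   ≡⟨ cong (_+ + m * (q + + 1)) (ℤP.m-n≡m⊖n r m) ⟩
      (r ⊖ m) + + m * (q + + 1)         ∎
      where open ≡-Reasoning
    small : 2 ℕ.* ∣ r ⊖ m ∣ ℕ.≤ m
    small rewrite ℤP.∣⊖∣-< (n%ℕd<d x m) = begin
      2 ℕ.* (m ℕ.∸ r)         ≡⟨ ℕP.*-distribˡ-∸ 2 m r ⟩
      2 ℕ.* m ℕ.∸ 2 ℕ.* r     ≤⟨ ℕP.∸-monoʳ-≤ (2 ℕ.* m) (ℕP.<⇒≤ (ℕP.≰⇒> large)) ⟩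
      2 ℕ.* m ℕ.∸ m           ≡⟨ cong (ℕ._∸ m) (ℕP.+-comm m (m ℕ.+ 0)) ⟩
      (m ℕ.+ 0) ℕ.+ m ℕ.∸ m   ≡⟨ ℕP.m+n∸n≡m (m ℕ.+ 0) m ⟩
      m ℕ.+ 0                 ≡⟨ ℕP.+-identityʳ m ⟩
      m                       ∎
      where open ℕP.≤-Reasoning

  double-multiple : ∀ y m u → 2 ℕ.* ∣ y ∣ ≡ m ℕ.* u → Σ ℤ λ e → + 2 * y ≡ + m * e
  double-multiple (+ a) m u eq = + u , trans (sym (ℤP.pos-* 2 a)) (trans (cong +_ eq) (ℤP.pos-* m u))
  double-multiple -[1+ a ] m u eq = - + u , (begin
    + 2 * -[1+ a ]        ≡⟨ ℤP.*-comm (+ 2) -[1+ a ] ⟩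
    -[1+ a ] * + 2        ≡⟨ ℤP.neg-distribˡ-* (+ suc a) (+ 2) ⟨
    - (+ suc a * + 2)     ≡⟨ cong -_ (ℤP.*-comm (+ suc a) (+ 2)) ⟩
    - (+ 2 * + suc a)     ≡⟨ cong -_ (ℤP.pos-* 2 (suc a)) ⟨
    - + (2 ℕ.* suc a)     ≡⟨ cong (λ t → - + t) eq ⟩
    - + (m ℕ.* u)         ≡⟨ cong -_ (ℤP.pos-* m u) ⟩
    - (+ m * + u)         ≡⟨ ℤP.neg-distribʳ-* (+ m) (+ u) ⟩
    + m * - + u           ∎)
    where open ≡-Reasoning

  -- Reduce the xᵢ to symmetric residues yᵢ mod m; then Σ yᵢ² = m r
  -- with r ≤ m, and Euler's identity divides (Σ xᵢ²)(Σ yᵢ²) = m² r p by m².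
  module Descent (m-1 p : ℕ) where
    open import Data.Nat.Divisibility using (_∣_; divides)

    m : ℕ
    m = suc m-1

    M : ℤ
    M = + m

    private
      shift-expanded : ∀ y1 y2 y3 y4 k1 k2 k3 k4 M →
        (y1 + M * k1) * (y1 + M * k1) + (y2 + M * k2) * (y2 + M * k2)
          + (y3 + M * k3) * (y3 + M * k3) + (y4 + M * k4) * (y4 + M * k4)
        ≡ (y1 * y1 + y2 * y2 + y3 * y3 + y4 * y4)
          + M * ((+ 2 * y1) * k1 + (+ 2 * y2) * k2 + (+ 2 * y3) * k3 + (+ 2 * y4) * k4)
          + M * M * (k1 * k1 + k2 * k2 + k3 * k3 + k4 * k4)
      shift-expanded = solve-∀

      product-expanded : ∀ y1 y2 y3 y4 k1 k2 k3 k4 M →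
        ((y1 + M * k1) * (y1 + M * k1) + (y2 + M * k2) * (y2 + M * k2)
          + (y3 + M * k3) * (y3 + M * k3) + (y4 + M * k4) * (y4 + M * k4))
          * (y1 * y1 + y2 * y2 + y3 * y3 + y4 * y4)
        ≡ ((y1 * y1 + y2 * y2 + y3 * y3 + y4 * y4) + M * (k1 * y1 + k2 * y2 + k3 * y3 + k4 * y4))
            * ((y1 * y1 + y2 * y2 + y3 * y3 + y4 * y4) + M * (k1 * y1 + k2 * y2 + k3 * y3 + k4 * y4))
          + (M * (k1 * y2 - k2 * y1 + k3 * y4 - k4 * y3)) * (M * (k1 * y2 - k2 * y1 + k3 * y4 - k4 * y3))
          + (M * (k1 * y3 - k2 * y4 - k3 * y1 + k4 * y2)) * (M * (k1 * y3 - k2 * y4 - k3 * y1 + k4 * y2))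
          + (M * (k1 * y4 + k2 * y3 - k3 * y2 - k4 * y1)) * (M * (k1 * y4 + k2 * y3 - k3 * y2 - k4 * y1))
      product-expanded = solve-∀

      common-factor-expanded : ∀ M R S w2 w3 w4 →
        (M * R + M * S) * (M * R + M * S) + (M * w2) * (M * w2) + (M * w3) * (M * w3) + (M * w4) * (M * w4)
        ≡ M * (M * ((R + S) * (R + S) + w2 * w2 + w3 * w3 + w4 * w4))
      common-factor-expanded = solve-∀

    sum4-shift : ∀ y1 y2 y3 y4 k1 k2 k3 k4 →
      sum4 (y1 + M * k1) (y2 + M * k2) (y3 + M * k3) (y4 + M * k4)
      ≡ sum4 y1 y2 y3 y4 + M * ((+ 2 * y1) * k1 + (+ 2 * y2) * k2 + (+ 2 * y3) * k3 + (+ 2 * y4) * k4)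
        + M * M * (k1 * k1 + k2 * k2 + k3 * k3 + k4 * k4)
    sum4-shift y1 y2 y3 y4 k1 k2 k3 k4 = shift-expanded y1 y2 y3 y4 k1 k2 k3 k4 M

    -- Euler's identity for the pair (y + Mk, y): every term but the first is divisible by M.
    sum4-product : ∀ y1 y2 y3 y4 k1 k2 k3 k4 →
      sum4 (y1 + M * k1) (y2 + M * k2) (y3 + M * k3) (y4 + M * k4) * sum4 y1 y2 y3 y4
      ≡ sum4 (sum4 y1 y2 y3 y4 + M * (k1 * y1 + k2 * y2 + k3 * y3 + k4 * y4))
             (M * (k1 * y2 - k2 * y1 + k3 * y4 - k4 * y3))
             (M * (k1 * y3 - k2 * y4 - k3 * y1 + k4 * y2))
             (M * (k1 * y4 + k2 * y3 - k3 * y2 - k4 * y1))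
    sum4-product y1 y2 y3 y4 k1 k2 k3 k4 = product-expanded y1 y2 y3 y4 k1 k2 k3 k4 M

    sum4-common-factor : ∀ R S w2 w3 w4 →
      sum4 (M * R + M * S) (M * w2) (M * w3) (M * w4) ≡ M * (M * sum4 (R + S) w2 w3 w4)
    sum4-common-factor = common-factor-expanded M

    -- The degenerate cases of the descent: if Σ yᵢ² = M² c and every 2yᵢ is a multiple of M,
    -- then M² divides Σ (yᵢ + M kᵢ)² = M p, hence m ∣ p.
    m∣p-if-degenerate : ∀ y1 y2 y3 y4 k1 k2 k3 k4 c e1 e2 e3 e4 →
      M * + p ≡ sum4 (y1 + M * k1) (y2 + M * k2) (y3 + M * k3) (y4 + M * k4) →
      sum4 y1 y2 y3 y4 ≡ M * M * c →
      + 2 * y1 ≡ M * e1 → + 2 * y2 ≡ M * e2 → + 2 * y3 ≡ M * e3 → + 2 * y4 ≡ M * e4 →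
      m ∣ p
    m∣p-if-degenerate y1 y2 y3 y4 k1 k2 k3 k4 c e1 e2 e3 e4 mp≡ sy≡ h1 h2 h3 h4 =
      divides ∣ Q ∣ (trans (cong ∣_∣ p≡MQ) (trans (ℤP.∣i*j∣≡∣i∣*∣j∣ M Q) (ℕP.*-comm m ∣ Q ∣)))
      where
      open ≡-Reasoning
      K = k1 * k1 + k2 * k2 + k3 * k3 + k4 * k4
      Q = c + e1 * k1 + e2 * k2 + e3 * k3 + e4 * k4 + K
      regroup : ∀ M c e1 e2 e3 e4 k1 k2 k3 k4 →
        M * M * c + M * ((M * e1) * k1 + (M * e2) * k2 + (M * e3) * k3 + (M * e4) * k4)
          + M * M * (k1 * k1 + k2 * k2 + k3 * k3 + k4 * k4)
        ≡ M * (M * (c + e1 * k1 + e2 * k2 + e3 * k3 + e4 * k4 + (k1 * k1 + k2 * k2 + k3 * k3 + k4 * k4)))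
      regroup = solve-∀
      Mp≡MMQ : M * + p ≡ M * (M * Q)
      Mp≡MMQ = begin
        M * + p                                              ≡⟨ mp≡ ⟩
        sum4 (y1 + M * k1) (y2 + M * k2) (y3 + M * k3) (y4 + M * k4) ≡⟨ sum4-shift y1 y2 y3 y4 k1 k2 k3 k4 ⟩
        sum4 y1 y2 y3 y4 + M * ((+ 2 * y1) * k1 + (+ 2 * y2) * k2 + (+ 2 * y3) * k3 + (+ 2 * y4) * k4) + M * M * K
          ≡⟨ cong₂ (λ a b → a + M * b + M * M * K) sy≡
               (cong₂ _+_ (cong₂ _+_ (cong₂ _+_ (cong (_* k1) h1) (cong (_* k2) h2)) (cong (_* k3) h3)) (cong (_* k4) h4)) ⟩
        M * M * c + M * ((M * e1) * k1 + (M * e2) * k2 + (M * e3) * k3 + (M * e4) * k4) + M * M * K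
          ≡⟨ regroup M c e1 e2 e3 e4 k1 k2 k3 k4 ⟩
        M * (M * Q)                                          ∎
      p≡MQ : + p ≡ M * Q
      p≡MQ = ℤP.*-cancelˡ-≡ M (+ p) (M * Q) Mp≡MMQ

    nonneg-if-multiple : ∀ {Y} R → + Y ≡ M * R → R ≡ + ∣ R ∣
    nonneg-if-multiple (+ _)    _  = refl
    nonneg-if-multiple -[1+ _ ] ()

    module FromResidues (y1 y2 y3 y4 k1 k2 k3 k4 : ℤ)
      (mp≡ : M * + p ≡ sum4 (y1 + M * k1) (y2 + M * k2) (y3 + M * k3) (y4 + M * k4))
      (b1 : 2 ℕ.* ∣ y1 ∣ ℕ.≤ m) (b2 : 2 ℕ.* ∣ y2 ∣ ℕ.≤ m)
      (b3 : 2 ℕ.* ∣ y3 ∣ ℕ.≤ m) (b4 : 2 ℕ.* ∣ y4 ∣ ℕ.≤ m) where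
      open ≡-Reasoning

      A B R : ℤ
      A = (+ 2 * y1) * k1 + (+ 2 * y2) * k2 + (+ 2 * y3) * k3 + (+ 2 * y4) * k4
      B = k1 * k1 + k2 * k2 + k3 * k3 + k4 * k4
      R = + p - A - M * B

      sum4y≡MR : sum4 y1 y2 y3 y4 ≡ M * R
      sum4y≡MR = begin
        sum4 y1 y2 y3 y4                       ≡⟨ unshift (sum4 y1 y2 y3 y4) A B M ⟩
        (sum4 y1 y2 y3 y4 + M * A + M * M * B) - M * A - M * M * B
          ≡⟨ cong (λ t → t - M * A - M * M * B) (trans (sym (sum4-shift y1 y2 y3 y4 k1 k2 k3 k4)) (sym mp≡)) ⟩
        M * + p - M * A - M * M * B            ≡⟨ factor M (+ p) A B ⟩
        M * R                                  ∎
        where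
        unshift : ∀ S A B M → S ≡ (S + M * A + M * M * B) - M * A - M * M * B
        unshift = solve-∀
        factor : ∀ M P A B → M * P - M * A - M * M * B ≡ M * (P - A - M * B)
        factor = solve-∀

      w1 w2 w3 w4 : ℤ
      w1 = R + (k1 * y1 + k2 * y2 + k3 * y3 + k4 * y4)
      w2 = k1 * y2 - k2 * y1 + k3 * y4 - k4 * y3
      w3 = k1 * y3 - k2 * y4 - k3 * y1 + k4 * y2
      w4 = k1 * y4 + k2 * y3 - k3 * y2 - k4 * y1

      -- M² R p = (Σ (yᵢ + M kᵢ)²)(Σ yᵢ²) = M² Σ wᵢ².
      Rp≡sum4w : R * + p ≡ sum4 w1 w2 w3 w4
      Rp≡sum4w = ℤP.*-cancelˡ-≡ M _ _ (ℤP.*-cancelˡ-≡ M _ _ (begin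
        M * (M * (R * + p))                   ≡⟨ rearrange M (+ p) R ⟩
        (M * + p) * (M * R)                   ≡⟨ cong₂ _*_ mp≡ (sym sum4y≡MR) ⟩
        sum4 (y1 + M * k1) (y2 + M * k2) (y3 + M * k3) (y4 + M * k4) * sum4 y1 y2 y3 y4
          ≡⟨ sum4-product y1 y2 y3 y4 k1 k2 k3 k4 ⟩
        sum4 (sum4 y1 y2 y3 y4 + M * Sky) (M * w2) (M * w3) (M * w4)
          ≡⟨ cong (λ t → sum4 (t + M * Sky) (M * w2) (M * w3) (M * w4)) sum4y≡MR ⟩
        sum4 (M * R + M * Sky) (M * w2) (M * w3) (M * w4)
          ≡⟨ sum4-common-factor R Sky w2 w3 w4 ⟩
        M * (M * sum4 w1 w2 w3 w4)            ∎))
        where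
        Sky = k1 * y1 + k2 * y2 + k3 * y3 + k4 * y4
        rearrange : ∀ M P R → M * (M * (R * P)) ≡ (M * P) * (M * R)
        rearrange = solve-∀

      Y : ℕ
      Y = sum4ℕ (∣ y1 ∣) (∣ y2 ∣) (∣ y3 ∣) (∣ y4 ∣)

      Y≡MR : + Y ≡ M * R
      Y≡MR = trans (sym (sum4-∣∣ y1 y2 y3 y4)) sum4y≡MR

      r : ℕ
      r = ∣ R ∣

      R≡r : R ≡ + r
      R≡r = nonneg-if-multiple R Y≡MR

      Y≡mr : Y ≡ m ℕ.* r
      Y≡mr = trans (cong ∣_∣ Y≡MR) (ℤP.∣i*j∣≡∣i∣*∣j∣ M R)

      r≤m : r ℕ.≤ m
      r≤m = ℕP.*-cancelˡ-≤ m (subst (ℕ._≤ m ℕ.* m) Y≡mr (sum4ℕ-halfBound {∣ y1 ∣} {∣ y2 ∣} {∣ y3 ∣} {∣ y4 ∣} b1 b2 b3 b4))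

      rp-representation : SumOfFourSquares (r ℕ.* p)
      rp-representation = w1 , w2 , w3 , w4 , trans (ℤP.pos-* r p) (trans (cong (_* + p) (sym R≡r)) Rp≡sum4w)

      m∣p-if-halves : ∀ u c → 2 ℕ.* ∣ y1 ∣ ≡ m ℕ.* u → 2 ℕ.* ∣ y2 ∣ ≡ m ℕ.* u →
        2 ℕ.* ∣ y3 ∣ ≡ m ℕ.* u → 2 ℕ.* ∣ y4 ∣ ≡ m ℕ.* u → sum4 y1 y2 y3 y4 ≡ M * M * c → m ∣ p
      m∣p-if-halves u c h1 h2 h3 h4 sy≡ with double-multiple y1 m u h1 | double-multiple y2 m u h2
                                          | double-multiple y3 m u h3 | double-multiple y4 m u h4
      ... | e1 , d1 | e2 , d2 | e3 , d3 | e4 , d4 =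
        m∣p-if-degenerate y1 y2 y3 y4 k1 k2 k3 k4 c e1 e2 e3 e4 mp≡ sy≡ d1 d2 d3 d4

      -- r = 0 forces all yᵢ = 0.
      r≢0 : ¬ (m ∣ p) → r ≢ 0
      r≢0 m∤p r≡0 = m∤p (m∣p-if-halves 0 (+ 0) (half z1) (half z2) (half z3) (half z4) sy≡0)
        where
        Y≡0 : Y ≡ 0
        Y≡0 = trans Y≡mr (trans (cong (m ℕ.*_) r≡0) (ℕP.*-zeroʳ m))
        zs = sum4ℕ≡0 {∣ y1 ∣} {∣ y2 ∣} {∣ y3 ∣} {∣ y4 ∣} Y≡0
        z1 = proj₁ zs
        z2 = proj₁ (proj₂ zs)
        z3 = proj₁ (proj₂ (proj₂ zs))
        z4 = proj₂ (proj₂ (proj₂ zs))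
        half : ∀ {a} → a ≡ 0 → 2 ℕ.* a ≡ m ℕ.* 0
        half a≡0 = trans (cong (2 ℕ.*_) a≡0) (sym (ℕP.*-zeroʳ m))
        sy≡0 : sum4 y1 y2 y3 y4 ≡ M * M * + 0
        sy≡0 = trans (sum4-∣∣ y1 y2 y3 y4) (trans (cong +_ Y≡0) (sym (ℤP.*-zeroʳ (M * M))))

      -- r = m forces all |yᵢ| = m/2.
      r≢m : ¬ (m ∣ p) → r ≢ m
      r≢m m∤p r≡m = m∤p (m∣p-if-halves 1 (+ 1) (half ∣ y1 ∣ t1) (half ∣ y2 ∣ t2) (half ∣ y3 ∣ t3) (half ∣ y4 ∣ t4) sy≡mm)
        where
        Y≡mm : Y ≡ m ℕ.* m
        Y≡mm = trans Y≡mr (cong (m ℕ.*_) r≡m)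
        ts = sum4ℕ-halfBound-tight {∣ y1 ∣} {∣ y2 ∣} {∣ y3 ∣} {∣ y4 ∣} b1 b2 b3 b4 Y≡mm
        t1 = proj₁ ts
        t2 = proj₁ (proj₂ ts)
        t3 = proj₁ (proj₂ (proj₂ ts))
        t4 = proj₂ (proj₂ (proj₂ ts))
        half : ∀ a → 2 ℕ.* a ≡ m → 2 ℕ.* a ≡ m ℕ.* 1
        half _ h = trans h (sym (ℕP.*-identityʳ m))
        sy≡mm : sum4 y1 y2 y3 y4 ≡ M * M * + 1
        sy≡mm = trans (sum4-∣∣ y1 y2 y3 y4)
          (trans (cong +_ Y≡mm) (trans (ℤP.pos-* m m) (sym (ℤP.*-identityʳ (M * M)))))

    descent-step : ¬ (m ∣ p) → SumOfFourSquares (m ℕ.* p) →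
      Σ ℕ λ r → (0 ℕ.< r) × (r ℕ.< m) × SumOfFourSquares (r ℕ.* p)
    descent-step m∤p (x1 , x2 , x3 , x4 , mp≡)
      with symmetricResidue x1 m | symmetricResidue x2 m | symmetricResidue x3 m | symmetricResidue x4 m
    ... | symRes k1 y1 s1 b1 | symRes k2 y2 s2 b2 | symRes k3 y3 s3 b3 | symRes k4 y4 s4 b4 =
      r , ℕP.n≢0⇒n>0 (r≢0 m∤p) , ℕP.≤∧≢⇒< r≤m (r≢m m∤p) , rp-representation
      where
      mp≡' : M * + p ≡ sum4 (y1 + M * k1) (y2 + M * k2) (y3 + M * k3) (y4 + M * k4)
      mp≡' = trans (sym (ℤP.pos-* m p)) (trans mp≡ (cong₂ (λ a b → a + b) (cong₂ (λ a b → a + b)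
               (cong₂ (λ a b → a + b) (cong (λ t → t * t) s1) (cong (λ t → t * t) s2))
               (cong (λ t → t * t) s3)) (cong (λ t → t * t) s4)))
      open FromResidues y1 y2 y3 y4 k1 k2 k3 k4 mp≡' b1 b2 b3 b4

  module Lagrange where
    open import Data.Nat.Divisibility using (_∣_; divides)
    open import Data.Nat.Divisibility.Core using (hasNonTrivialDivisor)
    open import Data.Nat.Primality using (Prime; composite?; ¬composite⇒prime; prime⇒nonTrivial)
    open import Data.Nat.Induction using (<-rec)
    open import Data.Nat.Tactic.RingSolver as ℕSolver using ()

    quotient-positive : ∀ {n} q d → suc n ≡ q ℕ.* d → 0 ℕ.< q
    quotient-positive (suc _) _ _ = s≤s z≤n

    private
      odd-square : ∀ h → h ℕ.* h ℕ.+ h ℕ.* h ℕ.+ 1 ℕ.+ (h ℕ.* h ℕ.+ h ℕ.* h ℕ.+ (h ℕ.+ h) ℕ.+ (h ℕ.+ h))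
                         ≡ suc (h ℕ.+ h) ℕ.* suc (h ℕ.+ h)
      odd-square = ℕSolver.solve-∀

    RepresentableMultiple : ℕ → Set
    RepresentableMultiple p = Σ ℕ λ m → (0 ℕ.< m) × (m ℕ.< p) × SumOfFourSquares (m ℕ.* p)

    -- For an odd prime p = 2h + 1 (h ≥ 1), a² + b² + 1² + 0² = m p with 0 < m < p.
    initial-multiple : ∀ h-1 → let p = suc (suc h-1 ℕ.+ suc h-1) in
      Prime p → RepresentableMultiple p
    initial-multiple h-1 pr with SquaresModOddPrime.sumOfSquaresPlusOneMultiple (suc h-1) pr
    ... | a , b , a≤h , b≤h , divides m eq = m , 0<m , m<p , representation
      where
      h = suc h-1
      p = suc (h ℕ.+ h)
      N = a ℕ.* a ℕ.+ b ℕ.* b ℕ.+ 1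
      0<m : 0 ℕ.< m
      0<m = quotient-positive m p (trans (ℕP.+-comm 1 (a ℕ.* a ℕ.+ b ℕ.* b)) eq)
      N<p² : N ℕ.< p ℕ.* p
      N<p² = ℕP.≤-<-trans (ℕP.+-monoˡ-≤ 1 (ℕP.+-mono-≤ (ℕP.*-mono-≤ a≤h a≤h) (ℕP.*-mono-≤ b≤h b≤h)))
               (subst (h ℕ.* h ℕ.+ h ℕ.* h ℕ.+ 1 ℕ.<_) (odd-square h) (ℕP.m<m+n _ (s≤s z≤n)))
      m<p : m ℕ.< p
      m<p = ℕP.*-cancelʳ-< p m p (subst (ℕ._< p ℕ.* p) eq N<p²)
      representation : SumOfFourSquares (m ℕ.* p)
      representation = + a , + b , + 1 , + 0 ,
        trans (cong +_ (trans (sym eq) (sym (ℕP.+-identityʳ N)))) (sym (sum4-∣∣ (+ a) (+ b) (+ 1) (+ 0)))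

    descend : ∀ {p} → Prime p → RepresentableMultiple p → SumOfFourSquares p
    descend {p} pr (m , 0<m , m<p , rep) =
      <-rec (λ m → 0 ℕ.< m → m ℕ.< p → SumOfFourSquares (m ℕ.* p) → SumOfFourSquares p) go m 0<m m<p rep
      where
      go : ∀ m → (∀ {r} → r ℕ.< m → 0 ℕ.< r → r ℕ.< p → SumOfFourSquares (r ℕ.* p) → SumOfFourSquares p) →
           0 ℕ.< m → m ℕ.< p → SumOfFourSquares (m ℕ.* p) → SumOfFourSquares p
      go (suc zero) _ _ _ rep = subst SumOfFourSquares (ℕP.+-identityʳ p) rep
      go (suc (suc m-2)) rec _ m<p rep = continue (Descent.descent-step (suc m-2) p m∤p rep)
        where
        m∤p : ¬ (suc (suc m-2) ∣ p)
        m∤p m∣p = Prime.notComposite pr (hasNonTrivialDivisor m<p m∣p)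
        continue : (Σ ℕ λ r → (0 ℕ.< r) × (r ℕ.< suc (suc m-2)) × SumOfFourSquares (r ℕ.* p)) →
                   SumOfFourSquares p
        continue (r , 0<r , r<m , rep') = rec r<m 0<r (ℕP.<-trans r<m m<p) rep'

    parity : ∀ n → Σ ℕ λ h → (n ≡ h ℕ.+ h) ⊎ (n ≡ suc (h ℕ.+ h))
    parity zero = 0 , inj₁ refl
    parity (suc n) with parity n
    ... | h , inj₁ n≡2h   = h , inj₂ (cong suc n≡2h)
    ... | h , inj₂ n≡2h+1 = suc h , inj₁ (cong suc (trans n≡2h+1 (sym (ℕP.+-suc h h))))

    sumOfFourSquares-prime : ∀ p → Prime p → SumOfFourSquares p
    sumOfFourSquares-prime p pr with parity p | ℕ.nonTrivial⇒n>1 p {{prime⇒nonTrivial pr}}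
    ... | zero , inj₁ refl | ()
    ... | zero , inj₂ refl | s≤s ()
    ... | suc zero , inj₁ refl | _ = + 1 , + 1 , + 0 , + 0 , refl
    ... | suc (suc h) , inj₁ refl | _ = ⊥-elim (Prime.notComposite pr (hasNonTrivialDivisor 2<p 2∣p))
      where
      h+2 = suc (suc h)
      2<p : 2 ℕ.< h+2 ℕ.+ h+2
      2<p = s≤s (s≤s (ℕP.≤-trans (s≤s z≤n) (ℕP.m≤n+m h+2 h)))
      2∣p : 2 ∣ h+2 ℕ.+ h+2
      2∣p = divides h+2 (trans (cong (h+2 ℕ.+_) (sym (ℕP.+-identityʳ h+2))) (ℕP.*-comm 2 h+2))
    ... | suc h-1 , inj₂ refl | _ = descend pr (initial-multiple h-1 pr)

    -- Every natural number is a sum of four squares: by strong induction, splitting composite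
    -- numbers into smaller factors and multiplying their representations.
    four-squares : ∀ n → SumOfFourSquares n
    four-squares = <-rec SumOfFourSquares go
      where
      go : ∀ n → (∀ {d} → d ℕ.< n → SumOfFourSquares d) → SumOfFourSquares n
      go zero _ = + 0 , + 0 , + 0 , + 0 , refl
      go (suc zero) _ = + 1 , + 0 , + 0 , + 0 , refl
      go n@(suc (suc _)) rec with composite? n
      ... | no ¬composite = sumOfFourSquares-prime n (¬composite⇒prime ¬composite)
      ... | yes (hasNonTrivialDivisor {zero} {{()}} _ _)
      ... | yes (hasNonTrivialDivisor {suc zero} {{()}} _ _)
      ... | yes (hasNonTrivialDivisor {d@(suc (suc _))} d<n (divides q n≡qd)) =
        subst SumOfFourSquares (sym n≡qd) (sumOfFourSquares-* (rec q<n) (rec d<n))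
        where
        0<q : 0 ℕ.< q
        0<q = quotient-positive q d n≡qd
        q<n : q ℕ.< n
        q<n = subst (q ℕ.<_) (sym n≡qd) (ℕP.m<m*n q d {{ℕ.>-nonZero 0<q}} (s≤s (s≤s z≤n)))

  open Lagrange public using (four-squares)

module Recursion where
  open import Defs
  open import Data.Nat
  open import Data.Nat.Properties
  open import Data.Fin using (zero; suc)
  open import Data.Vec using (Vec; []; _∷_)
  open import Data.Product using (_,_; proj₂; ∃)
  open import Relation.Binary.PropositionalEquality
  open import Relation.Binary using (tri<; tri≈; tri>)
  open import Function.Bundles using (mk⇔)

  -- Evaluation of partial recursive functions is deterministic.  For μ-minimisation this
  -- uses that the smaller of two candidate outputs would have been a zero passed over.
  mutual
    ⇓-deterministic : ∀ {n} {f : PR n} {xs y y'} → f ⊢ xs ⇓ y → f ⊢ xs ⇓ y' → y ≡ y'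
    ⇓-deterministic ev-zer ev-zer = refl
    ⇓-deterministic ev-succ ev-succ = refl
    ⇓-deterministic ev-proj ev-proj = refl
    ⇓-deterministic (ev-comp ds d) (ev-comp ds' d') with ⇓*-deterministic ds ds'
    ... | refl = ⇓-deterministic d d'
    ⇓-deterministic (ev-prec-z d) (ev-prec-z d') = ⇓-deterministic d d'
    ⇓-deterministic (ev-prec-s d e) (ev-prec-s d' e') with ⇓-deterministic d d'
    ... | refl = ⇓-deterministic e e'
    ⇓-deterministic (ev-mu {y = y} d below) (ev-mu {y = y'} d' below') with <-cmp y y'
    ... | tri≈ _ y≡y' _ = y≡y'
    ... | tri< y<y' _ _ with () ← ⇓-deterministic d (proj₂ (below' y y<y'))
    ... | tri> _ _ y>y' with () ← ⇓-deterministic d' (proj₂ (below y' y>y'))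

    ⇓*-deterministic : ∀ {m n} {gs : Vec (PR n) m} {xs ys ys'} → gs ⊢* xs ⇓ ys → gs ⊢* xs ⇓ ys' → ys ≡ ys'
    ⇓*-deterministic ev-[] ev-[] = refl
    ⇓*-deterministic (ev-∷ d ds) (ev-∷ d' ds') = cong₂ _∷_ (⇓-deterministic d d') (⇓*-deterministic ds ds')

  predPR : PR 1
  predPR = prec zer (proj zero)

  predPR-correct : ∀ k → predPR ⊢ (k ∷ []) ⇓ pred k
  predPR-correct zero = ev-prec-z ev-zer
  predPR-correct (suc k) = ev-prec-s (predPR-correct k) ev-proj

  monusPR : PR 2
  monusPR = prec (proj zero) (comp predPR (proj (suc zero) ∷ []))

  monusPR-correct : ∀ k x → monusPR ⊢ (k ∷ x ∷ []) ⇓ (x ∸ k)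
  monusPR-correct zero x = ev-prec-z ev-proj
  monusPR-correct (suc k) x = subst (monusPR ⊢ (suc k ∷ x ∷ []) ⇓_) (pred[m∸n]≡m∸[1+n] x k)
    (ev-prec-s (monusPR-correct k x) (ev-comp (ev-∷ ev-proj ev-[]) (predPR-correct (x ∸ k))))

  BelowGraph : (ℕ → ℕ) → Vec ℕ 2 → Set
  BelowGraph β (t ∷ b ∷ []) = b ≤ suc (β t)

  -- For computable β, BelowGraph β is the domain of (t, b) ↦ μz. (b ∸ (β t + 1)) and is
  -- therefore recursively enumerable.
  belowGraph-re : ∀ β → Computable β → RecursivelyEnumerable 2 (BelowGraph β)
  belowGraph-re β (cβ , cβ-correct) = domain , λ { (t ∷ b ∷ []) → mk⇔ (halts t b) (bounded t b) }
    where
    excess : PR 3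
    excess = comp monusPR (comp succ (comp cβ (proj (suc zero) ∷ []) ∷ []) ∷ proj (suc (suc zero)) ∷ [])

    excess-correct : ∀ z t b → excess ⊢ (z ∷ t ∷ b ∷ []) ⇓ (b ∸ suc (β t))
    excess-correct z t b = ev-comp
      (ev-∷ (ev-comp (ev-∷ (ev-comp (ev-∷ ev-proj ev-[]) (cβ-correct t)) ev-[]) ev-succ) (ev-∷ ev-proj ev-[]))
      (monusPR-correct (suc (β t)) b)

    domain : PR 2
    domain = mu excess

    halts : ∀ t b → b ≤ suc (β t) → ∃ λ y → domain ⊢ (t ∷ b ∷ []) ⇓ y
    halts t b b≤ = 0 , ev-mu (subst (excess ⊢ (0 ∷ t ∷ b ∷ []) ⇓_) (m≤n⇒m∸n≡0 b≤) (excess-correct 0 t b)) (λ _ ())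

    bounded : ∀ t b → (∃ λ y → domain ⊢ (t ∷ b ∷ []) ⇓ y) → b ≤ suc (β t)
    bounded t b (y , ev-mu d _) = m∸n≡0⇒m≤n (sym (⇓-deterministic d (excess-correct y t b)))

module StraightLine where
  open import Defs using (Poly; var; con; _⊕_; _⊗_; ⟦_⟧)
  open import Data.Nat as ℕ using (ℕ; zero; suc; _<_; _≤_; _≟_; _^_)
  import Data.Nat.Properties as ℕP
  open import Data.Integer using (ℤ; +_; -[1+_]; _+_; _*_; _-_)
  import Data.Integer.Properties as ℤP
  open import Data.Integer.Tactic.RingSolver using (solve-∀)
  open import Data.Fin using (Fin)
  open import Data.Vec using (Vec; lookup)
  open import Data.List using (List; []; _∷_; _++_)
  open import Data.List.Relation.Unary.All using (All; []; _∷_)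
  open import Data.List.Relation.Unary.All.Properties using (++⁺; ++⁻ˡ; ++⁻ʳ)
  open import Data.Unit using (⊤; tt)
  open import Data.Empty using (⊥; ⊥-elim)
  open import Data.Product using (_,_; _×_; proj₁; proj₂)
  open import Data.Sum using (inj₁; inj₂)
  open import Relation.Binary.PropositionalEquality
  open import Relation.Nullary using (yes; no)

  -- Register i of a straight-line program is computed by its i-th instruction: it reads the
  -- i-th input, is a constant, or combines two earlier registers.
  data Instr : Set where
    input const1 const0 : Instr
    add mul sub         : ℕ → ℕ → Instr

  infixl 5 _▷_
  data Program : Set where
    ε   : Program
    _▷_ : Program → Instr → Program

  len : Program → ℕ
  len ε       = 0
  len (P ▷ _) = suc (len P)

  exec : (ℕ → ℤ) → (ℕ → ℤ) → ℕ → Instr → ℤ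
  exec r ι i input     = ι i
  exec r ι i const1    = + 1
  exec r ι i const0    = + 0
  exec r ι i (add j k) = r j + r k
  exec r ι i (mul j k) = r j * r k
  exec r ι i (sub j k) = r j - r k

  -- Register contents after running P on inputs ι (registers beyond len P hold 0).
  run : (ℕ → ℤ) → Program → ℕ → ℤ
  run ι ε       i = + 0
  run ι (P ▷ c) i with i ≟ len P
  ... | yes _ = exec (run ι P) ι (len P) c
  ... | no _  = run ι P i

  run-last : ∀ ι P c → run ι (P ▷ c) (len P) ≡ exec (run ι P) ι (len P) c
  run-last ι P c with len P ≟ len P
  ... | yes _ = refl
  ... | no ≢  = ⊥-elim (≢ refl)

  run-earlier : ∀ ι P c i → i < len P → run ι (P ▷ c) i ≡ run ι P i
  run-earlier ι P c i i<len with i ≟ len P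
  ... | yes i≡len = ⊥-elim (ℕP.<-irrefl i≡len i<len)
  ... | no _      = refl

  data RegEq : Set where
    reg-one : ℕ → RegEq
    reg-add reg-mul : ℕ → ℕ → ℕ → RegEq

  Holds : (ℕ → ℤ) → RegEq → Set
  Holds ν (reg-one i)     = ν i ≡ + 1
  Holds ν (reg-add i j k) = ν i + ν j ≡ ν k
  Holds ν (reg-mul i j k) = ν i * ν j ≡ ν k

  -- The equation expressing instruction c at position i (0 as x + x = x, and a − b as
  -- x + b = a); inputs impose no equation.
  equationOf : ℕ → Instr → List RegEq
  equationOf i input     = []
  equationOf i const1    = reg-one i ∷ []
  equationOf i const0    = reg-add i i i ∷ []
  equationOf i (add j k) = reg-add j k i ∷ []
  equationOf i (mul j k) = reg-mul j k i ∷ []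
  equationOf i (sub j k) = reg-add i k j ∷ []

  equations : Program → List RegEq
  equations ε       = []
  equations (P ▷ c) = equationOf (len P) c ++ equations P

  OperandsBelow : ℕ → Instr → Set
  OperandsBelow i (add j k) = j < i × k < i
  OperandsBelow i (mul j k) = j < i × k < i
  OperandsBelow i (sub j k) = j < i × k < i
  OperandsBelow i _         = ⊤

  WellFormed : Program → Set
  WellFormed ε       = ⊤
  WellFormed (P ▷ c) = WellFormed P × OperandsBelow (len P) c

  InputsBelow : Program → ℕ → Set
  InputsBelow ε           B = ⊤
  InputsBelow (P ▷ input) B = InputsBelow P B × len P < B
  InputsBelow (P ▷ _)     B = InputsBelow P B

  private
    add-sub : ∀ a b → a ≡ (a + b) - b
    add-sub = solve-∀

    sub-add : ∀ a b → (a - b) + b ≡ a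
    sub-add = solve-∀

    +-to-- : ∀ x y z → x + y ≡ z → x ≡ z - y
    +-to-- x y z eq = trans (add-sub x y) (cong (_- y) eq)

  x+x≡x⇒x≡0 : ∀ x → x + x ≡ x → x ≡ + 0
  x+x≡x⇒x≡0 x eq = trans (+-to-- x x x eq) (ℤP.+-inverseʳ x)

  run-solves : ∀ P ι (ν : ℕ → ℤ) → WellFormed P → (∀ i → i < len P → ν i ≡ run ι P i) →
    All (Holds ν) (equations P)
  run-solves ε ι ν _ _ = []
  run-solves (P ▷ c) ι ν (wf , ok) agree = ++⁺ (last c ok νlast) (run-solves P ι ν wf agree′)
    where
    i = len P
    agree′ : ∀ j → j < len P → ν j ≡ run ι P j
    agree′ j j<i = trans (agree j (ℕP.m<n⇒m<1+n j<i)) (run-earlier ι P c j j<i)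
    νlast : ν i ≡ exec (run ι P) ι i c
    νlast = trans (agree i (ℕP.n<1+n i)) (run-last ι P c)
    last : ∀ c → OperandsBelow i c → ν i ≡ exec (run ι P) ι i c → All (Holds ν) (equationOf i c)
    last input     _          _ = []
    last const1    _          e = e ∷ []
    last const0    _          e = trans (cong₂ _+_ e e) (sym e) ∷ []
    last (add j k) (j< , k<)  e = trans (cong₂ _+_ (agree′ j j<) (agree′ k k<)) (sym e) ∷ []
    last (mul j k) (j< , k<)  e = trans (cong₂ _*_ (agree′ j j<) (agree′ k k<)) (sym e) ∷ []
    last (sub j k) (j< , k<)  e =
      trans (cong₂ _+_ e (agree′ k k<)) (trans (sub-add (run ι P j) (run ι P k)) (sym (agree′ j j<))) ∷ []

  solution-is-run : ∀ P ν → WellFormed P → All (Holds ν) (equations P) → ∀ i → i < len P → ν i ≡ run ν P i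
  solution-is-run ε ν _ _ i ()
  solution-is-run (P ▷ c) ν (wf , ok) sol i i<1+len with ℕP.m<1+n⇒m<n∨m≡n i<1+len
  ... | inj₁ i<len = trans (IH i i<len) (sym (run-earlier ν P c i i<len))
    where IH = solution-is-run P ν wf (++⁻ʳ (equationOf (len P) c) sol)
  ... | inj₂ refl = trans (last c ok (++⁻ˡ (equationOf (len P) c) sol)) (sym (run-last ν P c))
    where
    IH = solution-is-run P ν wf (++⁻ʳ (equationOf (len P) c) sol)
    last : ∀ c → OperandsBelow (len P) c → All (Holds ν) (equationOf (len P) c) →
      ν (len P) ≡ exec (run ν P) ν (len P) c
    last input     _         _        = refl
    last const1    _         (e ∷ []) = e
    last const0    _         (e ∷ []) = x+x≡x⇒x≡0 (ν (len P)) e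
    last (add j k) (j< , k<) (e ∷ []) = trans (sym e) (cong₂ _+_ (IH j j<) (IH k k<))
    last (mul j k) (j< , k<) (e ∷ []) = trans (sym e) (cong₂ _*_ (IH j j<) (IH k k<))
    last (sub j k) (j< , k<) (e ∷ []) =
      trans (+-to-- (ν (len P)) (ν k) (ν j) e) (cong₂ _-_ (IH j j<) (IH k k<))

  run-depends-on-inputs : ∀ P ι ι′ B → InputsBelow P B → (∀ i → i < B → ι i ≡ ι′ i) → ∀ i → run ι P i ≡ run ι′ P i
  run-depends-on-inputs ε ι ι′ B _ _ i = refl
  run-depends-on-inputs (P ▷ c) ι ι′ B below agree i with i ≟ len P
  ... | no _  = run-depends-on-inputs P ι ι′ B (inputsBelow-init c below) agree i
    where
    inputsBelow-init : ∀ c → InputsBelow (P ▷ c) B → InputsBelow P B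
    inputsBelow-init input     b = proj₁ b
    inputsBelow-init const1    b = b
    inputsBelow-init const0    b = b
    inputsBelow-init (add _ _) b = b
    inputsBelow-init (mul _ _) b = b
    inputsBelow-init (sub _ _) b = b
  ... | yes _ = last c below
    where
    IH : InputsBelow P B → ∀ j → run ι P j ≡ run ι′ P j
    IH b j = run-depends-on-inputs P ι ι′ B b agree j
    last : ∀ c → InputsBelow (P ▷ c) B → exec (run ι P) ι (len P) c ≡ exec (run ι′ P) ι′ (len P) c
    last input     (_ , lt) = agree (len P) lt
    last const1    _        = refl
    last const0    _        = refl
    last (add j k) b        = cong₂ _+_ (IH b j) (IH b k)
    last (mul j k) b        = cong₂ _*_ (IH b j) (IH b k)
    last (sub j k) b        = cong₂ _-_ (IH b j) (IH b k)

  record Extends (P Q : Program) : Set where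
    field
      run-kept         : ∀ ι i → i < len P → run ι Q i ≡ run ι P i
      wellFormed-kept  : WellFormed P → WellFormed Q
      inputsBelow-kept : ∀ B → InputsBelow P B → InputsBelow Q B
      len-≤            : len P ≤ len Q
  open Extends public

  extends-refl : ∀ P → Extends P P
  extends-refl P = record
    { run-kept = λ _ _ _ → refl ; wellFormed-kept = λ wf → wf ; inputsBelow-kept = λ _ b → b ; len-≤ = ℕP.≤-refl }

  extends-trans : ∀ {P Q R} → Extends P Q → Extends Q R → Extends P R
  extends-trans PQ QR = record
    { run-kept = λ ι i i< → trans (run-kept QR ι i (ℕP.≤-trans i< (len-≤ PQ))) (run-kept PQ ι i i<)
    ; wellFormed-kept = λ wf → wellFormed-kept QR (wellFormed-kept PQ wf)
    ; inputsBelow-kept = λ B b → inputsBelow-kept QR B (inputsBelow-kept PQ B b)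
    ; len-≤ = ℕP.≤-trans (len-≤ PQ) (len-≤ QR) }

  NotInput : Instr → Set
  NotInput input = ⊥
  NotInput _     = ⊤

  extends-▷ : ∀ P c → OperandsBelow (len P) c → NotInput c → Extends P (P ▷ c)
  extends-▷ P c ok notInput = record
    { run-kept = λ ι i i< → run-earlier ι P c i i<
    ; wellFormed-kept = λ wf → wf , ok
    ; inputsBelow-kept = λ B b → keep c notInput b
    ; len-≤ = ℕP.n≤1+n (len P) }
    where
    keep : ∀ {B} c → NotInput c → InputsBelow P B → InputsBelow (P ▷ c) B
    keep const1    _ b = b
    keep const0    _ b = b
    keep (add _ _) _ b = b
    keep (mul _ _) _ b = b
    keep (sub _ _) _ b = b

  ExtendsAt : Program → Program → ℕ → Set
  ExtendsAt P Q r = Extends P Q × r < len Q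

  -- Given the registers `env` holding the variables and registers o, z
  -- holding 1 and 0, a polynomial is appended to a program; a constant c costs |c| + O(1)
  -- instructions (repeated addition of 1), each operation one instruction.
  cost : ∀ {k} → Poly k → ℕ
  cost (var i) = 0
  cost (con (+ n)) = n
  cost (con -[1+ n ]) = suc (suc n)
  cost (p ⊕ q) = suc (cost p ℕ.+ cost q)
  cost (p ⊗ q) = suc (cost p ℕ.+ cost q)

  module Compile {k : ℕ} (env : Fin k → ℕ) (o z : ℕ) where

    record InRange (P : Program) : Set where
      field
        env< : ∀ i → env i < len P
        o<   : o < len P
        z<   : z < len P
    open InRange

    inRange-extends : ∀ {P Q} → Extends P Q → InRange P → InRange Q
    inRange-extends PQ r = record
      { env< = λ i → ℕP.≤-trans (env< r i) (len-≤ PQ)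
      ; o< = ℕP.≤-trans (o< r) (len-≤ PQ)
      ; z< = ℕP.≤-trans (z< r) (len-≤ PQ) }

    numeral : Program → ℕ → Program
    numeral-reg : Program → ℕ → ℕ
    numeral P zero    = P
    numeral P (suc n) = numeral P n ▷ add (numeral-reg P n) o
    numeral-reg P zero    = z
    numeral-reg P (suc n) = len (numeral P n)

    constant : Program → ℤ → Program
    constant P (+ n)    = numeral P n
    constant P -[1+ n ] = numeral P (suc n) ▷ sub z (numeral-reg P (suc n))

    constant-reg : Program → ℤ → ℕ
    constant-reg P (+ n)    = numeral-reg P n
    constant-reg P -[1+ n ] = len (numeral P (suc n))

    compile : Program → Poly k → Program
    compile-reg : Program → Poly k → ℕ
    compile P (var i) = P
    compile P (con c) = constant P c
    compile P (p ⊕ q) = compile (compile P p) q ▷ add (compile-reg P p) (compile-reg (compile P p) q)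
    compile P (p ⊗ q) = compile (compile P p) q ▷ mul (compile-reg P p) (compile-reg (compile P p) q)
    compile-reg P (var i) = env i
    compile-reg P (con c) = constant-reg P c
    compile-reg P (p ⊕ q) = len (compile (compile P p) q)
    compile-reg P (p ⊗ q) = len (compile (compile P p) q)

    private
      len-numeral : ∀ P n → len (numeral P n) ≡ len P ℕ.+ n
      len-numeral P zero    = sym (ℕP.+-identityʳ (len P))
      len-numeral P (suc n) = trans (cong suc (len-numeral P n)) (sym (ℕP.+-suc (len P) n))

      len-binary : ∀ P p q → len (compile (compile P p) q) ≡ len P ℕ.+ cost p ℕ.+ cost q →
        suc (len (compile (compile P p) q)) ≡ len P ℕ.+ suc (cost p ℕ.+ cost q)
      len-binary P p q eq = trans (cong suc (trans eq (ℕP.+-assoc (len P) (cost p) (cost q))))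
                                  (sym (ℕP.+-suc (len P) _))

    len-compile : ∀ P p → len (compile P p) ≡ len P ℕ.+ cost p
    len-compile P (var i)        = sym (ℕP.+-identityʳ (len P))
    len-compile P (con (+ n))    = len-numeral P n
    len-compile P (con -[1+ n ]) = trans (cong suc (len-numeral P (suc n))) (sym (ℕP.+-suc (len P) (suc n)))
    len-compile P (p ⊕ q) = len-binary P p q
      (trans (len-compile (compile P p) q) (cong (ℕ._+ cost q) (len-compile P p)))
    len-compile P (p ⊗ q) = len-binary P p q
      (trans (len-compile (compile P p) q) (cong (ℕ._+ cost q) (len-compile P p)))

    numeral-extends : ∀ P n → InRange P → ExtendsAt P (numeral P n) (numeral-reg P n)
    numeral-extends P zero    r = extends-refl P , z< r
    numeral-extends P (suc n) r with numeral-extends P n r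
    ... | ext , reg< = extends-trans ext (extends-▷ _ (add _ o) (reg< , o< (inRange-extends ext r)) tt)
                     , ℕP.n<1+n _

    constant-extends : ∀ P c → InRange P → ExtendsAt P (constant P c) (constant-reg P c)
    constant-extends P (+ n)    r = numeral-extends P n r
    constant-extends P -[1+ n ] r with numeral-extends P (suc n) r
    ... | ext , reg< = extends-trans ext (extends-▷ _ (sub z _) (z< (inRange-extends ext r) , reg<) tt)
                     , ℕP.n<1+n _

    compile-extends : ∀ P p → InRange P → ExtendsAt P (compile P p) (compile-reg P p)
    compile-extends P (var i) r = extends-refl P , env< r i
    compile-extends P (con c) r = constant-extends P c r
    compile-extends P (p ⊕ q) r with compile-extends P p r
    ... | ext₁ , reg₁< with compile-extends (compile P p) q (inRange-extends ext₁ r)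
    ... | ext₂ , reg₂< = extends-trans (extends-trans ext₁ ext₂)
                           (extends-▷ _ (add _ _) (ℕP.≤-trans reg₁< (len-≤ ext₂) , reg₂<) tt) , ℕP.n<1+n _
    compile-extends P (p ⊗ q) r with compile-extends P p r
    ... | ext₁ , reg₁< with compile-extends (compile P p) q (inRange-extends ext₁ r)
    ... | ext₂ , reg₂< = extends-trans (extends-trans ext₁ ext₂)
                           (extends-▷ _ (mul _ _) (ℕP.≤-trans reg₁< (len-≤ ext₂) , reg₂<) tt) , ℕP.n<1+n _

    module Correctness (ι : ℕ → ℤ) where
      record Holding (P : Program) (v : Vec ℤ k) : Set where
        field
          inRange : InRange P
          run-o   : run ι P o ≡ + 1
          run-z   : run ι P z ≡ + 0
          run-env : ∀ i → run ι P (env i) ≡ lookup v i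
      open Holding

      holding-extends : ∀ {P Q v} → Extends P Q → Holding P v → Holding Q v
      holding-extends PQ h = record
        { inRange = inRange-extends PQ (inRange h)
        ; run-o = trans (run-kept PQ ι o (o< (inRange h))) (run-o h)
        ; run-z = trans (run-kept PQ ι z (z< (inRange h))) (run-z h)
        ; run-env = λ i → trans (run-kept PQ ι (env i) (env< (inRange h) i)) (run-env h i) }

      run-numeral : ∀ P n {v} → Holding P v → run ι (numeral P n) (numeral-reg P n) ≡ + n
      run-numeral P zero    h = run-z h
      run-numeral P (suc n) h = begin
        run ι (Q ▷ add (numeral-reg P n) o) (len Q)  ≡⟨ run-last ι Q _ ⟩
        run ι Q (numeral-reg P n) + run ι Q o         ≡⟨ cong₂ _+_ (run-numeral P n h) (run-o hQ) ⟩
        + n + + 1                                     ≡⟨ cong +_ (ℕP.+-comm n 1) ⟩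
        + suc n                                       ∎
        where
        open ≡-Reasoning
        Q = numeral P n
        hQ = holding-extends (proj₁ (numeral-extends P n (inRange h))) h

      run-constant : ∀ P c {v} → Holding P v → run ι (constant P c) (constant-reg P c) ≡ c
      run-constant P (+ n)    h = run-numeral P n h
      run-constant P -[1+ n ] h = begin
        run ι (Q ▷ sub z (numeral-reg P (suc n))) (len Q)   ≡⟨ run-last ι Q _ ⟩
        run ι Q z - run ι Q (numeral-reg P (suc n))          ≡⟨ cong₂ _-_ (run-z hQ) (run-numeral P (suc n) h) ⟩
        -[1+ n ]                                             ∎
        where
        open ≡-Reasoning
        Q = numeral P (suc n)
        hQ = holding-extends (proj₁ (numeral-extends P (suc n) (inRange h))) h

      run-compile : ∀ P p {v} → Holding P v → run ι (compile P p) (compile-reg P p) ≡ ⟦ p ⟧ v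
      run-compile P (var i) h = run-env h i
      run-compile P (con c) h = run-constant P c h
      run-compile P (p ⊕ q) {v} h = begin
        run ι (Q ▷ add r s) (len Q)   ≡⟨ run-last ι Q _ ⟩
        run ι Q r + run ι Q s         ≡⟨ cong₂ _+_ (trans (run-kept ext₂ ι r reg₁<) (run-compile P p h))
                                                   (run-compile P₁ q (holding-extends ext₁ h)) ⟩
        ⟦ p ⟧ v + ⟦ q ⟧ v             ∎
        where
        open ≡-Reasoning
        P₁ = compile P p
        Q = compile P₁ q
        r = compile-reg P p
        s = compile-reg P₁ q
        ext₁ = proj₁ (compile-extends P p (inRange h))
        reg₁< = proj₂ (compile-extends P p (inRange h))
        ext₂ = proj₁ (compile-extends P₁ q (inRange-extends ext₁ (inRange h)))
      run-compile P (p ⊗ q) {v} h = begin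
        run ι (Q ▷ mul r s) (len Q)   ≡⟨ run-last ι Q _ ⟩
        run ι Q r * run ι Q s         ≡⟨ cong₂ _*_ (trans (run-kept ext₂ ι r reg₁<) (run-compile P p h))
                                                   (run-compile P₁ q (holding-extends ext₁ h)) ⟩
        ⟦ p ⟧ v * ⟦ q ⟧ v             ∎
        where
        open ≡-Reasoning
        P₁ = compile P p
        Q = compile P₁ q
        r = compile-reg P p
        s = compile-reg P₁ q
        ext₁ = proj₁ (compile-extends P p (inRange h))
        reg₁< = proj₂ (compile-extends P p (inRange h))
        ext₂ = proj₁ (compile-extends P₁ q (inRange-extends ext₁ (inRange h)))

  module Doubling (o : ℕ) where
    doubling : Program → ℕ → Program
    doubling-reg : Program → ℕ → ℕ
    doubling P zero    = P
    doubling P (suc k) = doubling P k ▷ add (doubling-reg P k) (doubling-reg P k)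
    doubling-reg P zero    = o
    doubling-reg P (suc k) = len (doubling P k)

    len-doubling : ∀ P k → len (doubling P k) ≡ len P ℕ.+ k
    len-doubling P zero    = sym (ℕP.+-identityʳ (len P))
    len-doubling P (suc k) = trans (cong suc (len-doubling P k)) (sym (ℕP.+-suc (len P) k))

    doubling-extends : ∀ P k → o < len P → ExtendsAt P (doubling P k) (doubling-reg P k)
    doubling-extends P zero    o< = extends-refl P , o<
    doubling-extends P (suc k) o< with doubling-extends P k o<
    ... | ext , reg< = extends-trans ext (extends-▷ _ (add _ _) (reg< , reg<) tt) , ℕP.n<1+n _

    run-doubling : ∀ ι P k → run ι P o ≡ + 1 → run ι (doubling P k) (doubling-reg P k) ≡ + (2 ^ k)
    run-doubling ι P zero    run-o = run-o
    run-doubling ι P (suc k) run-o = begin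
      run ι (doubling P k ▷ add r r) (len (doubling P k))  ≡⟨ run-last ι (doubling P k) _ ⟩
      run ι (doubling P k) r + run ι (doubling P k) r       ≡⟨ cong₂ _+_ IH IH ⟩
      + (2 ^ k ℕ.+ 2 ^ k)                                   ≡⟨ cong (λ t → + (2 ^ k ℕ.+ t)) (ℕP.+-identityʳ (2 ^ k)) ⟨
      + (2 ^ suc k)                                         ∎
      where
      open ≡-Reasoning
      r = doubling-reg P k
      IH = run-doubling ι P k run-o

  pad : Program → ℕ → Program
  pad P zero    = P
  pad P (suc j) = pad P j ▷ const1

  len-pad : ∀ P j → len (pad P j) ≡ len P ℕ.+ j
  len-pad P zero    = sym (ℕP.+-identityʳ (len P))
  len-pad P (suc j) = trans (cong suc (len-pad P j)) (sym (ℕP.+-suc (len P) j))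

  pad-extends : ∀ P j → Extends P (pad P j)
  pad-extends P zero    = extends-refl P
  pad-extends P (suc j) = extends-trans (pad-extends P j) (extends-▷ _ const1 tt tt)

  inputs : ℕ → Program
  inputs zero    = ε
  inputs (suc n) = inputs n ▷ input

  len-inputs : ∀ n → len (inputs n) ≡ n
  len-inputs zero    = refl
  len-inputs (suc n) = cong suc (len-inputs n)

  inputs-wellFormed : ∀ n → WellFormed (inputs n)
  inputs-wellFormed zero    = tt
  inputs-wellFormed (suc n) = inputs-wellFormed n , tt

  inputsBelow-weaken : ∀ P {B} → InputsBelow P B → InputsBelow P (suc B)
  inputsBelow-weaken ε                 _        = tt
  inputsBelow-weaken (P ▷ input)       (b , lt) = inputsBelow-weaken P b , ℕP.m<n⇒m<1+n lt
  inputsBelow-weaken (P ▷ const1)      b        = inputsBelow-weaken P b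
  inputsBelow-weaken (P ▷ const0)      b        = inputsBelow-weaken P b
  inputsBelow-weaken (P ▷ add _ _)     b        = inputsBelow-weaken P b
  inputsBelow-weaken (P ▷ mul _ _)     b        = inputsBelow-weaken P b
  inputsBelow-weaken (P ▷ sub _ _)     b        = inputsBelow-weaken P b

  inputs-inputsBelow : ∀ n → InputsBelow (inputs n) n
  inputs-inputsBelow zero    = tt
  inputs-inputsBelow (suc n) = inputsBelow-weaken (inputs n) (inputs-inputsBelow n)
                             , subst (_< suc n) (sym (len-inputs n)) (ℕP.n<1+n n)

  run-inputs : ∀ ι n i → i < n → run ι (inputs n) i ≡ ι i
  run-inputs ι (suc n) i i< with ℕP.m<1+n⇒m<n∨m≡n i<
  ... | inj₁ i<n = trans (run-earlier ι (inputs n) input i (subst (i <_) (sym (len-inputs n)) i<n))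
                         (run-inputs ι n i i<n)
  ... | inj₂ refl = trans (cong (run ι (inputs (suc i))) (sym (len-inputs i)))
                          (trans (run-last ι (inputs i) input) (cong ι (len-inputs i)))

module Finite where
  open import Data.Nat as ℕ using (ℕ; zero; suc; z≤n; _<_; _≤_; _<?_)
  import Data.Nat.Properties as ℕP
  open import Data.Integer using (ℤ; +_; -[1+_]; ∣_∣)
  open import Data.Fin as Fin using (Fin; toℕ; fromℕ<)
  import Data.Fin.Properties as FinP
  open import Data.Vec using (Vec; []; _∷_; lookup; sum)
  open import Data.List using (List; []; _∷_; cartesianProductWith)
  open import Data.List.Membership.Propositional using (_∈_)
  open import Data.List.Membership.Propositional.Properties using (∈-cartesianProductWith⁺)
  open import Data.List.Relation.Unary.Any using (here; there)
  open import Data.Sum using (inj₁; inj₂)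
  open import Data.Empty using (⊥-elim)
  open import Relation.Binary.PropositionalEquality
  open import Relation.Nullary using (yes; no)

  integersUpTo : ℕ → List ℤ
  integersUpTo zero    = + 0 ∷ []
  integersUpTo (suc B) = + suc B ∷ -[1+ B ] ∷ integersUpTo B

  ∈-integersUpTo : ∀ z B → ∣ z ∣ ≤ B → z ∈ integersUpTo B
  ∈-integersUpTo (+ zero) zero _ = here refl
  ∈-integersUpTo z (suc B) |z|≤ with ℕP.m≤n⇒m<n∨m≡n |z|≤
  ... | inj₁ |z|< = there (there (∈-integersUpTo z B (ℕ.s≤s⁻¹ |z|<)))
  ∈-integersUpTo (+ suc n) (suc B) _ | inj₂ refl = here refl
  ∈-integersUpTo -[1+ n ]  (suc B) _ | inj₂ refl = there (here refl)

  vectorsUpTo : (L : ℕ) → ℕ → List (Vec ℤ L)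
  vectorsUpTo zero    B = [] ∷ []
  vectorsUpTo (suc L) B = cartesianProductWith _∷_ (integersUpTo B) (vectorsUpTo L B)

  ∈-vectorsUpTo : ∀ L B (v : Vec ℤ L) → (∀ i → ∣ lookup v i ∣ ≤ B) → v ∈ vectorsUpTo L B
  ∈-vectorsUpTo zero    B []      _ = here refl
  ∈-vectorsUpTo (suc L) B (x ∷ v) bounded =
    ∈-cartesianProductWith⁺ _∷_ (∈-integersUpTo x B (bounded Fin.zero)) (∈-vectorsUpTo L B v (bounded ∘ Fin.suc))
    where open import Function using (_∘_)

  module Bounds {m : ℕ} where
    entryBound : List (Vec ℕ m) → ℕ
    entryBound []       = 0
    entryBound (x ∷ xs) = sum x ℕ.+ entryBound xs

    lookup≤sum : ∀ {l} (x : Vec ℕ l) j → lookup x j ≤ sum x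
    lookup≤sum (x ∷ xs) Fin.zero    = ℕP.m≤m+n x (sum xs)
    lookup≤sum (x ∷ xs) (Fin.suc j) = ℕP.≤-trans (lookup≤sum xs j) (ℕP.m≤n+m (sum xs) x)

    entry≤entryBound : ∀ {x xs} j → x ∈ xs → lookup x j ≤ entryBound xs
    entry≤entryBound {x} {xs = _ ∷ xs} j (here refl) = ℕP.≤-trans (lookup≤sum x j) (ℕP.m≤m+n (sum x) (entryBound xs))
    entry≤entryBound {xs = y ∷ xs} j (there x∈) = ℕP.≤-trans (entry≤entryBound j x∈) (ℕP.m≤n+m (entryBound xs) (sum y))

    familyBound : (ℕ → List (Vec ℕ m)) → ℕ → ℕ
    familyBound f zero    = entryBound (f 0)
    familyBound f (suc s) = familyBound f s ℕ.+ entryBound (f (suc s))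

    entry≤familyBound : ∀ f s {b x} j → b ≤ s → x ∈ f b → lookup x j ≤ familyBound f s
    entry≤familyBound f zero    j z≤n x∈ = entry≤entryBound j x∈
    entry≤familyBound f (suc s) {b} j b≤ x∈ with ℕP.m≤n⇒m<n∨m≡n b≤
    ... | inj₁ b<  = ℕP.≤-trans (entry≤familyBound f s j (ℕ.s≤s⁻¹ b<) x∈) (ℕP.m≤m+n _ _)
    ... | inj₂ refl = ℕP.≤-trans (entry≤entryBound j x∈) (ℕP.m≤n+m _ (familyBound f s))

  module Indexing where
    -- The index i as an element of Fin n, or 0 if i ≥ n.
    clamp : ∀ {n} → 0 < n → ℕ → Fin n
    clamp {n} 0<n i with i <? n
    ... | yes i<n = fromℕ< i<n
    ... | no _    = fromℕ< 0<n

    clamp-toℕ : ∀ {n} (0<n : 0 < n) (i : Fin n) → clamp 0<n (toℕ i) ≡ i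
    clamp-toℕ {n} 0<n i with toℕ i <? n
    ... | yes i<n = FinP.fromℕ<-toℕ i i<n
    ... | no i≮n  = ⊥-elim (i≮n (FinP.toℕ<n i))

    toℕ-clamp : ∀ {n} (0<n : 0 < n) i → i < n → toℕ (clamp 0<n i) ≡ i
    toℕ-clamp {n} 0<n i i<n with i <? n
    ... | yes i<n′ = FinP.toℕ-fromℕ< i<n′
    ... | no i≮n   = ⊥-elim (i≮n i<n)

    lookupOr0 : ∀ {L} → Vec ℤ L → ℕ → ℤ
    lookupOr0 {L} v i with i <? L
    ... | yes i<L = lookup v (fromℕ< i<L)
    ... | no _    = + 0

    lookupOr0-toℕ : ∀ {L} (v : Vec ℤ L) (i : Fin L) → lookupOr0 v (toℕ i) ≡ lookup v i
    lookupOr0-toℕ {L} v i with toℕ i <? L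
    ... | yes i<L = cong (lookup v) (FinP.fromℕ<-toℕ i i<L)
    ... | no i≮L  = ⊥-elim (i≮L (FinP.toℕ<n i))

module SystemEncoding where
  open import Defs
  open FourSquares
  open StraightLine
  open Finite
  open import Data.Nat as ℕ using (ℕ; zero; suc; z≤n; s≤s; _<_; _≤_; _^_)
  import Data.Nat.Properties as ℕP
  open import Data.Integer using (ℤ; +_; ∣_∣; _+_; _*_)
  open import Data.Fin as Fin using (Fin; toℕ; fromℕ<; combine; remQuot)
  import Data.Fin.Properties as FinP
  open import Data.Vec as Vec using (Vec; []; _∷_; lookup; tabulate)
  import Data.Vec.Properties as VecP
  open import Data.List as List using (List; []; _∷_)
  open import Data.List.Membership.Propositional using (_∈_)
  open import Data.List.Membership.Propositional.Properties using (∈-map⁺)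
  open import Data.List.Relation.Unary.All as All using (All; []; _∷_)
  import Data.List.Relation.Unary.All.Properties as AllP
  open import Data.Product using (Σ; _,_; _×_; proj₁; proj₂)
  open import Relation.Binary.PropositionalEquality
  open import Function.Bundles using (Equivalence)
  open Recursion using (BelowGraph)

  substitute : ∀ {k k′} → Poly k → (Fin k → Poly k′) → Poly k′
  substitute (var i) σ = σ i
  substitute (con c) σ = con c
  substitute (p ⊕ q) σ = substitute p σ ⊕ substitute q σ
  substitute (p ⊗ q) σ = substitute p σ ⊗ substitute q σ

  ⟦substitute⟧ : ∀ {k k′} (p : Poly k) (σ : Fin k → Poly k′) (v : Vec ℤ k′) →
    ⟦ substitute p σ ⟧ v ≡ ⟦ p ⟧ (tabulate (λ j → ⟦ σ j ⟧ v))
  ⟦substitute⟧ (var i) σ v = sym (VecP.lookup∘tabulate (λ j → ⟦ σ j ⟧ v) i)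
  ⟦substitute⟧ (con c) σ v = refl
  ⟦substitute⟧ (p ⊕ q) σ v = cong₂ _+_ (⟦substitute⟧ p σ v) (⟦substitute⟧ q σ v)
  ⟦substitute⟧ (p ⊗ q) σ v = cong₂ _*_ (⟦substitute⟧ p σ v) (⟦substitute⟧ q σ v)

  q₀ q₁ q₂ q₃ : Fin 4
  q₀ = Fin.zero
  q₁ = Fin.suc Fin.zero
  q₂ = Fin.suc (Fin.suc Fin.zero)
  q₃ = Fin.suc (Fin.suc (Fin.suc Fin.zero))

  sumOfSquares : (Fin 4 → ℤ) → ℤ
  sumOfSquares g = sum4 (g q₀) (g q₁) (g q₂) (g q₃)

  sumOfSquaresPoly : ∀ {k} → (Fin 4 → Poly k) → Poly k
  sumOfSquaresPoly f = (((f q₀ ⊗ f q₀) ⊕ (f q₁ ⊗ f q₁)) ⊕ (f q₂ ⊗ f q₂)) ⊕ (f q₃ ⊗ f q₃)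

  sumOfSquares-cong : ∀ {g h : Fin 4 → ℤ} → (∀ r → g r ≡ h r) → sumOfSquares g ≡ sumOfSquares h
  sumOfSquares-cong {g} {h} g≗h = cong₂ _+_ (cong₂ _+_ (cong₂ _+_ (square q₀) (square q₁)) (square q₂)) (square q₃)
    where
    square : ∀ r → g r * g r ≡ h r * h r
    square r = cong₂ _*_ (g≗h r) (g≗h r)

  sumOfSquares-nonneg : ∀ g → + ∣ sumOfSquares g ∣ ≡ sumOfSquares g
  sumOfSquares-nonneg g = trans (cong (λ t → + ∣ t ∣) eq) (sym eq)
    where eq = sum4-∣∣ (g q₀) (g q₁) (g q₂) (g q₃)

  component≤sumOfSquares : ∀ g r → ∣ g r ∣ ≤ ∣ sumOfSquares g ∣
  component≤sumOfSquares g r =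
    subst (∣ g r ∣ ≤_) (cong ∣_∣ (sym (sum4-∣∣ (g q₀) (g q₁) (g q₂) (g q₃))))
      (pick r (≤sum4ℕ (∣ g q₀ ∣) (∣ g q₁ ∣) (∣ g q₂ ∣) (∣ g q₃ ∣)))
    where
    pick : ∀ {S} r → (∣ g q₀ ∣ ≤ S) × (∣ g q₁ ∣ ≤ S) × (∣ g q₂ ∣ ≤ S) × (∣ g q₃ ∣ ≤ S) → ∣ g r ∣ ≤ S
    pick Fin.zero                             (b , _ , _ , _) = b
    pick (Fin.suc Fin.zero)                   (_ , b , _ , _) = b
    pick (Fin.suc (Fin.suc Fin.zero))         (_ , _ , b , _) = b
    pick (Fin.suc (Fin.suc (Fin.suc Fin.zero))) (_ , _ , _ , b) = b

  squareRoots : ∀ {n} → SumOfFourSquares n → Fin 4 → ℤ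
  squareRoots (a , _ , _ , _ , _) Fin.zero = a
  squareRoots (_ , b , _ , _ , _) (Fin.suc Fin.zero) = b
  squareRoots (_ , _ , c , _ , _) (Fin.suc (Fin.suc Fin.zero)) = c
  squareRoots (_ , _ , _ , d , _) (Fin.suc (Fin.suc (Fin.suc Fin.zero))) = d

  ∣sumOfSquares-squareRoots∣ : ∀ {n} (rep : SumOfFourSquares n) → ∣ sumOfSquares (squareRoots rep) ∣ ≡ n
  ∣sumOfSquares-squareRoots∣ (_ , _ , _ , _ , eq) = cong ∣_∣ (sym eq)

  NaturalSolution : ∀ {m} → Poly (2 ℕ.+ m) → ℕ → ℕ → Vec ℕ m → Set
  NaturalSolution W t b x = ⟦ W ⟧ (toℤs ((t ∷ b ∷ []) Vec.++ x)) ≡ + 0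

  -- Each of the 1 + m natural unknowns u (u = 0 is b, u = j + 1 is xⱼ) is the sum of the
  -- squares of four integer inputs.  One straight-line program computes b, then 2ᵏ by
  -- doubling, then W(2ᵏ, b, x); its equations plus w + w = w for the register w holding W form
  -- the system, after padding the program to exactly n registers.
  module Encoding {m : ℕ} (W : Poly (2 ℕ.+ m)) where
    L : ℕ
    L = suc m ℕ.* 4

    slot : Fin (suc m) → Fin 4 → Fin L
    slot = combine

    unknown : (ℕ → ℤ) → Fin (suc m) → ℕ
    unknown ι u = ∣ sumOfSquares (λ r → ι (toℕ (slot u r))) ∣

    unknowns : (ℕ → ℤ) → Vec ℕ m
    unknowns ι = tabulate (λ j → unknown ι (Fin.suc j))

    one-reg zero-reg : ℕ
    one-reg = len (inputs L)
    zero-reg = suc one-reg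

    P₀ : Program
    P₀ = inputs L ▷ const1 ▷ const0

    private
      L≤len-P₀ : L ≤ len P₀
      L≤len-P₀ = subst (_≤ len P₀) (len-inputs L) (ℕP.≤-trans (ℕP.n≤1+n one-reg) (ℕP.n≤1+n zero-reg))

    run-P₀-input : ∀ ι i → i < L → run ι P₀ i ≡ ι i
    run-P₀-input ι i i<L = trans (run-earlier ι (inputs L ▷ const1) const0 i (ℕP.m<n⇒m<1+n i<one))
      (trans (run-earlier ι (inputs L) const1 i i<one) (run-inputs ι L i i<L))
      where
      i<one : i < one-reg
      i<one = subst (i <_) (sym (len-inputs L)) i<L

    run-P₀-one : ∀ ι → run ι P₀ one-reg ≡ + 1
    run-P₀-one ι = trans (run-earlier ι (inputs L ▷ const1) const0 one-reg (ℕP.n<1+n one-reg))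
                         (run-last ι (inputs L) const1)

    run-P₀-zero : ∀ ι → run ι P₀ zero-reg ≡ + 0
    run-P₀-zero ι = run-last ι (inputs L ▷ const1) const0

    module CompileInputs = Compile {L} toℕ one-reg zero-reg

    inRange-P₀ : CompileInputs.InRange P₀
    inRange-P₀ = record
      { env< = λ c → ℕP.≤-trans (FinP.toℕ<n c) L≤len-P₀
      ; o< = ℕP.≤-trans (ℕP.n<1+n one-reg) (ℕP.n≤1+n zero-reg)
      ; z< = ℕP.n<1+n zero-reg }

    bPoly : Poly L
    bPoly = sumOfSquaresPoly (λ r → var (slot Fin.zero r))

    Pb : Program
    Pb = CompileInputs.compile P₀ bPoly

    b-reg : ℕ
    b-reg = CompileInputs.compile-reg P₀ bPoly

    P₀⊑Pb : ExtendsAt P₀ Pb b-reg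
    P₀⊑Pb = CompileInputs.compile-extends P₀ bPoly inRange-P₀

    run-b : ∀ ι → run ι Pb b-reg ≡ sumOfSquares (λ r → ι (toℕ (slot Fin.zero r)))
    run-b ι = trans (run-compile P₀ bPoly holding)
      (sumOfSquares-cong λ r → trans (VecP.lookup∘tabulate (λ c → run ι P₀ (toℕ c)) (slot Fin.zero r))
                                     (run-P₀-input ι _ (FinP.toℕ<n (slot Fin.zero r))))
      where
      open CompileInputs.Correctness ι
      holding : Holding P₀ (tabulate (λ c → run ι P₀ (toℕ c)))
      holding = record
        { inRange = inRange-P₀ ; run-o = run-P₀-one ι ; run-z = run-P₀-zero ι
        ; run-env = λ c → sym (VecP.lookup∘tabulate (λ c → run ι P₀ (toℕ c)) c) }

    -- Stage 3 polynomial: W with variable 0 read from a register (holding 2ᵏ) and the other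
    -- unknowns replaced by sums of squares of inputs.
    σ : Fin (2 ℕ.+ m) → Poly (suc L)
    σ Fin.zero    = var Fin.zero
    σ (Fin.suc u) = sumOfSquaresPoly (λ r → var (Fin.suc (slot u r)))

    W′ : Poly (suc L)
    W′ = substitute W σ

    module WithExponent (k : ℕ) where
      open Doubling one-reg

      Pt : Program
      Pt = doubling Pb k

      t-reg : ℕ
      t-reg = doubling-reg Pb k

      Pb⊑Pt : ExtendsAt Pb Pt t-reg
      Pb⊑Pt = doubling-extends Pb k (ℕP.≤-trans (CompileInputs.InRange.o< inRange-P₀) (len-≤ (proj₁ P₀⊑Pb)))

      P₀⊑Pt : Extends P₀ Pt
      P₀⊑Pt = extends-trans (proj₁ P₀⊑Pb) (proj₁ Pb⊑Pt)

      run-t : ∀ ι → run ι Pt t-reg ≡ + (2 ^ k)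
      run-t ι = run-doubling ι Pb k (trans (run-kept (proj₁ P₀⊑Pb) ι one-reg (CompileInputs.InRange.o< inRange-P₀))
                                           (run-P₀-one ι))

      env : Fin (suc L) → ℕ
      env Fin.zero    = t-reg
      env (Fin.suc c) = toℕ c

      module CompileW = Compile env one-reg zero-reg

      PW : Program
      PW = CompileW.compile Pt W′

      w-reg : ℕ
      w-reg = CompileW.compile-reg Pt W′

      inRange-Pt : CompileW.InRange Pt
      inRange-Pt = record
        { env< = env<
        ; o< = ℕP.≤-trans (CompileInputs.InRange.o< inRange-P₀) (len-≤ P₀⊑Pt)
        ; z< = ℕP.≤-trans (CompileInputs.InRange.z< inRange-P₀) (len-≤ P₀⊑Pt) }
        where
        env< : ∀ c → env c < len Pt
        env< Fin.zero    = proj₂ Pb⊑Pt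
        env< (Fin.suc c) = ℕP.≤-trans (CompileInputs.InRange.env< inRange-P₀ c) (len-≤ P₀⊑Pt)

      Pt⊑PW : ExtendsAt Pt PW w-reg
      Pt⊑PW = CompileW.compile-extends Pt W′ inRange-Pt

      len-PW : len PW ≡ len Pb ℕ.+ k ℕ.+ cost W′
      len-PW = trans (CompileW.len-compile Pt W′) (cong (ℕ._+ cost W′) (len-doubling Pb k))

      run-w : ∀ ι → run ι PW w-reg ≡ ⟦ W ⟧ (toℤs ((2 ^ k ∷ unknown ι Fin.zero ∷ []) Vec.++ unknowns ι))
      run-w ι = begin
        run ι PW w-reg                                    ≡⟨ run-compile Pt W′ holding ⟩
        ⟦ W′ ⟧ registers                                  ≡⟨ ⟦substitute⟧ W σ registers ⟩
        ⟦ W ⟧ (tabulate (λ j → ⟦ σ j ⟧ registers))        ≡⟨ cong ⟦ W ⟧ substituted ⟩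
        ⟦ W ⟧ (toℤs ((2 ^ k ∷ unknown ι Fin.zero ∷ []) Vec.++ unknowns ι)) ∎
        where
        open ≡-Reasoning
        open CompileW.Correctness ι
        registers : Vec ℤ (suc L)
        registers = tabulate (λ c → run ι Pt (env c))
        holding : Holding Pt registers
        holding = record
          { inRange = inRange-Pt
          ; run-o = trans (run-kept P₀⊑Pt ι one-reg (CompileInputs.InRange.o< inRange-P₀)) (run-P₀-one ι)
          ; run-z = trans (run-kept P₀⊑Pt ι zero-reg (CompileInputs.InRange.z< inRange-P₀)) (run-P₀-zero ι)
          ; run-env = λ c → sym (VecP.lookup∘tabulate (λ c → run ι Pt (env c)) c) }
        input-register : ∀ c → lookup registers (Fin.suc c) ≡ ι (toℕ c)
        input-register c = trans (VecP.lookup∘tabulate (λ c → run ι Pt (env c)) (Fin.suc c))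
          (trans (run-kept P₀⊑Pt ι (toℕ c) (CompileInputs.InRange.env< inRange-P₀ c))
                 (run-P₀-input ι (toℕ c) (FinP.toℕ<n c)))
        unknown-value : ∀ u → ⟦ σ (Fin.suc u) ⟧ registers ≡ + unknown ι u
        unknown-value u = trans (sumOfSquares-cong (λ r → input-register (slot u r)))
                                (sym (sumOfSquares-nonneg (λ r → ι (toℕ (slot u r)))))
        substituted : tabulate (λ j → ⟦ σ j ⟧ registers) ≡ toℤs ((2 ^ k ∷ unknown ι Fin.zero ∷ []) Vec.++ unknowns ι)
        substituted = cong₂ _∷_ (run-t ι) (cong₂ _∷_ (unknown-value Fin.zero)
          (trans (VecP.tabulate-cong (λ j → unknown-value (Fin.suc j)))
                 (VecP.tabulate-∘ +_ (λ j → unknown ι (Fin.suc j)))))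

    -- 2ᵏ registers suffice once k > len Pb + cost W′, since c < 2ᶜ.
    opaque
      exponent : ℕ
      exponent = suc (len Pb ℕ.+ cost W′)

      exponent-def : exponent ≡ suc (len Pb ℕ.+ cost W′)
      exponent-def = refl

    open WithExponent exponent public

    n : ℕ
    n = 2 ^ exponent

    0<n : 0 < n
    0<n = ℕP.m^n>0 2 exponent

    private
      c<2^c : ∀ c → c < 2 ^ c
      c<2^c zero    = s≤s z≤n
      c<2^c (suc c) = subst (_≤ 2 ^ c ℕ.+ (2 ^ c ℕ.+ 0)) (ℕP.+-comm (suc c) 1)
        (ℕP.+-mono-≤ (c<2^c c) (subst (1 ≤_) (sym (ℕP.+-identityʳ (2 ^ c))) (ℕP.m^n>0 2 c)))

      length-bound : ∀ a c → a ℕ.+ suc (a ℕ.+ c) ℕ.+ c ≤ 2 ^ suc (a ℕ.+ c)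
      length-bound a c = subst (_≤ 2 ^ suc (a ℕ.+ c)) (sym regroup)
        (ℕP.+-mono-≤ (ℕP.<⇒≤ (c<2^c (a ℕ.+ c))) (subst (suc (a ℕ.+ c) ≤_) (sym (ℕP.+-identityʳ _)) (c<2^c (a ℕ.+ c))))
        where
        regroup : a ℕ.+ suc (a ℕ.+ c) ℕ.+ c ≡ (a ℕ.+ c) ℕ.+ suc (a ℕ.+ c)
        regroup = trans (ℕP.+-assoc a (suc (a ℕ.+ c)) c)
          (trans (cong (a ℕ.+_) (ℕP.+-comm (suc (a ℕ.+ c)) c)) (sym (ℕP.+-assoc a c (suc (a ℕ.+ c)))))

    len-PW≤n : len PW ≤ n
    len-PW≤n = subst (_≤ n) (sym len-PW)
      (subst (λ k → len Pb ℕ.+ k ℕ.+ cost W′ ≤ 2 ^ k) (sym exponent-def) (length-bound (len Pb) (cost W′)))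

    P : Program
    P = pad PW (n ℕ.∸ len PW)

    len-P : len P ≡ n
    len-P = trans (len-pad PW _) (ℕP.m+[n∸m]≡n len-PW≤n)

    PW⊑P : Extends PW P
    PW⊑P = pad-extends PW _

    P₀⊑P : Extends P₀ P
    P₀⊑P = extends-trans P₀⊑Pt (extends-trans (proj₁ Pt⊑PW) PW⊑P)

    wellFormed-P : WellFormed P
    wellFormed-P = wellFormed-kept P₀⊑P ((inputs-wellFormed L , tt) , tt)
      where open import Data.Unit using (tt)

    inputsBelow-P : InputsBelow P L
    inputsBelow-P = inputsBelow-kept P₀⊑P L (inputs-inputsBelow L)

    w<len-P : w-reg < len P
    w<len-P = ℕP.≤-trans (proj₂ Pt⊑PW) (len-≤ PW⊑P)

    b<len-P : b-reg < len P
    b<len-P = ℕP.≤-trans (proj₂ P₀⊑Pb) (len-≤ (extends-trans (proj₁ Pb⊑Pt) (extends-trans (proj₁ Pt⊑PW) PW⊑P)))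

    -- The system: the equations of P and w + w = w, with register i as unknown xᵢ.
    register : ℕ → Fin n
    register = Indexing.clamp 0<n

    regEquations : List RegEq
    regEquations = equations P List.++ (reg-add w-reg w-reg w-reg ∷ [])

    toEquation : RegEq → Equation n
    toEquation (reg-one i)     = one (register i)
    toEquation (reg-add i j k) = add (register i) (register j) (register k)
    toEquation (reg-mul i j k) = mul (register i) (register j) (register k)

    system : System n
    system = List.map toEquation regEquations

    registers : Vec ℤ n → ℕ → ℤ
    registers y i = lookup y (register i)

    solves⇒holds : ∀ y → Solves y system → All (Holds (registers y)) regEquations
    solves⇒holds y sol = All.map (λ {e} → from e) (AllP.map⁻ sol)
      where
      from : ∀ e → SatisfiesEq y (toEquation e) → Holds (registers y) e
      from (reg-one _)     h = h
      from (reg-add _ _ _) h = h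
      from (reg-mul _ _ _) h = h

    holds⇒solves : ∀ y → All (Holds (registers y)) regEquations → Solves y system
    holds⇒solves y holds = AllP.map⁺ (All.map (λ {e} → to e) holds)
      where
      to : ∀ e → Holds (registers y) e → SatisfiesEq y (toEquation e)
      to (reg-one _)     h = h
      to (reg-add _ _ _) h = h
      to (reg-mul _ _ _) h = h

    -- By Lagrange's theorem every unknown is a sum
    -- of four squares; run P on these square roots as inputs.
    module FromNaturalSolution (b : ℕ) (x : Vec ℕ m) (nat-sol : NaturalSolution W n b x) where
      value : Fin (suc m) → ℕ
      value Fin.zero    = b
      value (Fin.suc j) = lookup x j

      roots : Fin (suc m) → Fin 4 → ℤ
      roots u = squareRoots (four-squares (value u))

      rootsAt : Fin L → ℤ
      rootsAt c = roots (proj₁ (remQuot {suc m} 4 c)) (proj₂ (remQuot {suc m} 4 c))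

      ι : ℕ → ℤ
      ι = Indexing.lookupOr0 (tabulate rootsAt)

      ι-slot : ∀ u r → ι (toℕ (slot u r)) ≡ roots u r
      ι-slot u r = trans (Indexing.lookupOr0-toℕ (tabulate rootsAt) (slot u r))
        (trans (VecP.lookup∘tabulate rootsAt (slot u r))
               (cong (λ qr → roots (proj₁ qr) (proj₂ qr)) (FinP.remQuot-combine u r)))

      unknown-ι : ∀ u → unknown ι u ≡ value u
      unknown-ι u = trans (cong ∣_∣ (sumOfSquares-cong (ι-slot u))) (∣sumOfSquares-squareRoots∣ (four-squares (value u)))

      unknowns-ι : unknowns ι ≡ x
      unknowns-ι = trans (VecP.tabulate-cong (λ j → unknown-ι (Fin.suc j))) (VecP.tabulate∘lookup x)

      run-w≡0 : run ι PW w-reg ≡ + 0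
      run-w≡0 = trans (run-w ι) (trans (cong₂ (λ b x → ⟦ W ⟧ (toℤs ((n ∷ b ∷ []) Vec.++ x))) (unknown-ι Fin.zero) unknowns-ι) nat-sol)

      y : Vec ℤ n
      y = tabulate (λ i → run ι P (toℕ i))

      registers-y : ∀ i → i < len P → registers y i ≡ run ι P i
      registers-y i i<len = trans (VecP.lookup∘tabulate (λ i → run ι P (toℕ i)) (register i))
        (cong (run ι P) (Indexing.toℕ-clamp 0<n i (subst (i <_) len-P i<len)))

      solves : Solves y system
      solves = holds⇒solves y (AllP.++⁺ (run-solves P ι (registers y) wellFormed-P registers-y) (w+w≡w ∷ []))
        where
        w≡0 : registers y w-reg ≡ + 0
        w≡0 = trans (registers-y w-reg w<len-P) (trans (run-kept PW⊑P ι w-reg (proj₂ Pt⊑PW)) run-w≡0)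
        w+w≡w : registers y w-reg + registers y w-reg ≡ registers y w-reg
        w+w≡w = trans (cong₂ _+_ w≡0 w≡0) (sym w≡0)

      b-holds-b : ∣ registers y b-reg ∣ ≡ b
      b-holds-b = trans (cong ∣_∣ (trans (registers-y b-reg b<len-P) (trans (run-kept Pb⊑P ι b-reg (proj₂ P₀⊑Pb)) (run-b ι))))
                        (unknown-ι Fin.zero)
        where
        Pb⊑P : Extends Pb P
        Pb⊑P = extends-trans (proj₁ Pb⊑Pt) (extends-trans (proj₁ Pt⊑PW) PW⊑P)

    -- Soundness: a solution y of the system is the run of P on its first L entries, and these
    -- represent a natural solution of W(n, b, x) = 0.
    inputsOf : Vec ℤ n → Vec ℤ L
    inputsOf y = tabulate (λ c → registers y (toℕ c))

    runOn : Vec ℤ L → Vec ℤ n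
    runOn c = tabulate (λ i → run (Indexing.lookupOr0 c) P (toℕ i))

    module FromSolution (y : Vec ℤ n) (sol : Solves y system) where
      ν : ℕ → ℤ
      ν = registers y

      holds : All (Holds ν) regEquations
      holds = solves⇒holds y sol

      is-run : ∀ i → i < len P → ν i ≡ run ν P i
      is-run = solution-is-run P ν wellFormed-P (AllP.++⁻ˡ (equations P) holds)

      natural-solution : NaturalSolution W n (unknown ν Fin.zero) (unknowns ν)
      natural-solution with AllP.++⁻ʳ (equations P) holds
      ... | w+w≡w ∷ [] = trans (sym (run-w ν)) (trans (sym (run-kept PW⊑P ν w-reg (proj₂ Pt⊑PW)))
                           (trans (sym (is-run w-reg w<len-P)) (x+x≡x⇒x≡0 (ν w-reg) w+w≡w)))

      determined-by-inputs : y ≡ runOn (inputsOf y)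
      determined-by-inputs = trans (sym (VecP.tabulate∘lookup y)) (VecP.tabulate-cong entry)
        where
        inputs-agree : ∀ i → i < L → ν i ≡ Indexing.lookupOr0 (inputsOf y) i
        inputs-agree i i<L = sym (trans (cong (Indexing.lookupOr0 (inputsOf y)) (sym (FinP.toℕ-fromℕ< i<L)))
          (trans (Indexing.lookupOr0-toℕ (inputsOf y) (fromℕ< i<L))
            (trans (VecP.lookup∘tabulate (λ c → ν (toℕ c)) (fromℕ< i<L)) (cong ν (FinP.toℕ-fromℕ< i<L)))))
        entry : ∀ i → lookup y i ≡ run (Indexing.lookupOr0 (inputsOf y)) P (toℕ i)
        entry i = trans (cong (lookup y) (sym (Indexing.clamp-toℕ 0<n i)))
          (trans (is-run (toℕ i) (subst (toℕ i <_) (sym len-P) (FinP.toℕ<n i)))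
                 (run-depends-on-inputs P ν _ L inputsBelow-P inputs-agree (toℕ i)))

      inputs-bounded : ∀ B → (∀ u → unknown ν u ≤ B) → ∀ c → ∣ lookup (inputsOf y) c ∣ ≤ B
      inputs-bounded B unknown≤ c = subst (λ t → ∣ t ∣ ≤ B) (sym (VecP.lookup∘tabulate (λ c → ν (toℕ c)) c))
        (subst (λ c′ → ∣ ν (toℕ c′) ∣ ≤ B) (FinP.combine-remQuot {suc m} 4 c)
          (ℕP.≤-trans (component≤sumOfSquares (λ r → ν (toℕ (slot u r))) r) (unknown≤ u)))
        where
        u = proj₁ (remQuot {suc m} 4 c)
        r = proj₂ (remQuot {suc m} 4 c)

    -- If the natural solutions of W(n, b, x) = 0 are bounded, the system has finitely many
    -- solutions: each is determined by its first L entries, which are then bounded too.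
    finitely-many : ∀ B → (∀ b x → NaturalSolution W n b x → b ≤ B × (∀ j → lookup x j ≤ B)) →
      FinitelyManySolutions system
    finitely-many B bounded = List.map runOn (vectorsUpTo L B) , λ y sol →
      let open FromSolution y sol
          b≤B , x≤B = bounded _ _ natural-solution
          unknown≤ : ∀ u → unknown ν u ≤ B
          unknown≤ = λ { Fin.zero → b≤B
                       ; (Fin.suc j) → subst (_≤ B) (VecP.lookup∘tabulate (λ j → unknown ν (Fin.suc j)) j) (x≤B j) }
      in subst (_∈ List.map runOn (vectorsUpTo L B)) (sym determined-by-inputs)
           (∈-map⁺ runOn (∈-vectorsUpTo L B (inputsOf y) (inputs-bounded B unknown≤)))

  -- The natural solutions of W(n, b, x) = 0 have b ≤ β n + 1 and x in one of the finitely
  -- many finite lists provided by finite-foldness, so the encoded system has finitely many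
  -- solutions; yet (n, β n + 1) ∈ BelowGraph β yields a solution with an entry β n + 1.
  module Refutation (β : ℕ → ℕ) {m : ℕ} (W : Poly (2 ℕ.+ m))
    (rep : IsDiophantineRep 2 m (BelowGraph β) W) (finite-fold : IsFiniteFold 2 m W) where
    open Encoding W public
    open Bounds using (familyBound; entry≤familyBound)

    solutionsFor : ℕ → List (Vec ℕ m)
    solutionsFor b = proj₁ (finite-fold (n ∷ b ∷ []))

    bound : ℕ
    bound = suc (β n) ℕ.+ familyBound solutionsFor (suc (β n))

    bounded : ∀ b x → NaturalSolution W n b x → b ≤ bound × (∀ j → lookup x j ≤ bound)
    bounded b x nat-sol =
      ℕP.≤-trans b≤ (ℕP.m≤m+n (suc (β n)) _) ,
      λ j → ℕP.≤-trans (entry≤familyBound solutionsFor (suc (β n)) j b≤ (proj₂ (finite-fold (n ∷ b ∷ [])) x nat-sol))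
                       (ℕP.m≤n+m _ (suc (β n)))
      where
      b≤ : b ≤ suc (β n)
      b≤ = Equivalence.from (rep (n ∷ b ∷ [])) (x , nat-sol)

    finitely-many-solutions : FinitelyManySolutions system
    finitely-many-solutions = finitely-many bound bounded

    witness : Σ (Vec ℕ m) (NaturalSolution W n (suc (β n)))
    witness = Equivalence.to (rep (n ∷ suc (β n) ∷ [])) ℕP.≤-refl

    open FromNaturalSolution (suc (β n)) (proj₁ witness) (proj₂ witness) public
      using (y; solves; b-holds-b)

theorem2 : (β : ℕ → ℕ) → Computable β →
    ¬ ( ((n : ℕ) → 1 ≤ n → (M : Vec ℕ n → Set) →
           RecursivelyEnumerable n M → HasFiniteFoldDiophantineRep n M)
      × ((n : ℕ) → 1 ≤ n → (S : System n) → FinitelyManySolutions S →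
           (x : Vec ℤ n) → Solves x S → (i : Fin n) → ∣ lookup x i ∣ ≤ β n) )
theorem2 β computable (matiyasevich , a-priori-bound) =
  let m , W , rep , finite-fold = matiyasevich 2 (s≤s z≤n) (Recursion.BelowGraph β) (Recursion.belowGraph-re β computable)
      open SystemEncoding.Refutation β W rep finite-fold
        using (n; 0<n; system; finitely-many-solutions; y; solves; register; b-reg; b-holds-b)
  in  <-irrefl refl (subst (_≤ β n) b-holds-b
        (a-priori-bound n 0<n system finitely-many-solutions y solves (register b-reg)))
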